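{- Let $D$ be a connected ribbon of size $n$ whose first row has exactly one box. If $c(D)>1/2+n/4$, then $\mathfrak{r}_D$ is not $p$-positive.
   Context: Boxes are indexed $(i,j)$, row $i$ from the top, column $j$ from the left. For a composition $\alpha=(\alpha_1,\dots,\alpha_\ell)$, the connected ribbon $\alpha$ is the set of boxes in which row $i$ has $\alpha_i$ consecutive boxes and, for $i<\ell$, the leftmost box of row $i$ lies directly above the rightmost box of row $i+1$; its size is $\sum\alpha_i$. A marked shifted tableau of it is a filling by letters of $\{1'<1<2'<2<\cdots\}$ with weakly increasing rows and columns, at most one unmarked $k$ per column and at most one $k'$ per row for each $k$; the content $(c_1,c_2,\dots)$ counts entries with unmarked value $i$. $\mathfrak{r}_D=\sum_Tx_1^{c_1}x_2^{c_2}\cdots$ over all such tableaux. A box $(i,j)$ of $D$ is a corner if $(i-1,j)\in D$ and $(i+1,j)\notin D$; $c(D)$ is the number of corners. A symmetric function is $p$-positive if all its coefficients in the power sum basis $p_\lambda=\prod p_{\lambda_i}$, $p_r=\sum_jx_j^r$, are nonnegative. -}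

module Defs where

open import Data.Nat using (ℕ; zero; suc; _+_; _*_; _∸_; _<_)
open import Data.Nat as ℕ using (_≡ᵇ_; _<ᵇ_)
open import Data.Bool using (Bool; true; false; _∧_; _∨_; not; if_then_else_)
open import Data.List using (List; []; _∷_; _++_; map; concatMap; length; filter; zip; upTo; foldr)
open import Data.Nat.ListAction using (sum)
open import Data.Bool.ListAction using (all)
open import Data.List.Relation.Unary.All using (All)
open import Data.Product using (_×_; _,_; proj₁; proj₂; ∃)
open import Data.Integer using (+_)
open import Data.Rational as ℚ using (ℚ; 0ℚ)
open import Relation.Binary.PropositionalEquality using (_≡_)
open import Relation.Nullary using (¬_)
open import Relation.Nullary.Decidable using (⌊_⌋)

-- A composition is a list α = (α₁,…,αℓ) of positive naturals.
-- Boxes are pairs (row , column), rows numbered 1..ℓ from the top.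
-- Placement: the bottom row ℓ starts in column 1; the leftmost box of row i
-- is directly above the rightmost box of row i+1, i.e.
--   start(i) = start(i+1) + α_{i+1} - 1.
-- (Translating the ribbon changes neither tableaux nor corners.)

topStart : List ℕ → ℕ
topStart [] = 1
topStart (a ∷ []) = 1
topStart (a ∷ b ∷ rest) = topStart (b ∷ rest) + b ∸ 1

Box : Set
Box = ℕ × ℕ

boxesFrom : ℕ → List ℕ → List Box
boxesFrom i [] = []
boxesFrom i (a ∷ rest) =
  map (λ k → (i , topStart (a ∷ rest) + k)) (upTo a) ++ boxesFrom (suc i) rest

ribbon : List ℕ → List Box
ribbon α = boxesFrom 1 α

size : List ℕ → ℕ
size α = sum α

box≡ᵇ : Box → Box → Bool
box≡ᵇ (i , j) (k , l) = (i ≡ᵇ k) ∧ (j ≡ᵇ l)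

memᵇ : Box → List Box → Bool
memᵇ b [] = false
memᵇ b (x ∷ xs) = box≡ᵇ b x ∨ memᵇ b xs

-- (i,j) ∈ D is a corner iff (i-1,j) ∈ D and (i+1,j) ∉ D
-- (row indices start at 1, so i ∸ 1 = 0 is never a row of D)
isCorner : List Box → Box → Bool
isCorner D (i , j) = memᵇ (i ∸ 1 , j) D ∧ not (memᵇ (suc i , j) D)

corners : List ℕ → ℕ
corners α = length (filter (λ b → isCorner (ribbon α) b ≟ᵇ true) (ribbon α))
  where
  open import Data.Bool using () renaming (_≟_ to _≟ᵇ_)

-- Marked letters 1' < 1 < 2' < 2 < ⋯ :  a letter is (value , marked?)
-- with value ≥ 1; k' is (k , true), k is (k , false).

Letter : Set
Letter = ℕ × Bool

val : Letter → ℕ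
val = proj₁

marked : Letter → Bool
marked = proj₂

_≤Lᵇ_ : Letter → Letter → Bool
(k , m) ≤Lᵇ (l , m') = (k <ᵇ l) ∨ ((k ≡ᵇ l) ∧ (m ∨ not m'))

letters : ℕ → List Letter
letters m = concatMap (λ v → (suc v , true) ∷ (suc v , false) ∷ []) (upTo m)

fillings : ℕ → ℕ → List (List Letter)
fillings m zero = [] ∷ []
fillings m (suc k) = concatMap (λ x → map (x ∷_) (fillings m k)) (letters m)

pairOK : Box × Letter → Box × Letter → Bool
pairOK ((i₁ , j₁) , x₁) ((i₂ , j₂) , x₂) =
  (not ((i₁ ≡ᵇ i₂) ∧ (j₂ ≡ᵇ suc j₁)) ∨ (x₁ ≤Lᵇ x₂)) ∧
  (not ((j₁ ≡ᵇ j₂) ∧ (i₂ ≡ᵇ suc i₁)) ∨ (x₁ ≤Lᵇ x₂)) ∧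
  -- at most one unmarked k per column
  (not ((j₁ ≡ᵇ j₂) ∧ not (i₁ ≡ᵇ i₂) ∧ not (marked x₁) ∧ not (marked x₂)
        ∧ (val x₁ ≡ᵇ val x₂))) ∧
  -- at most one k' per row
  (not ((i₁ ≡ᵇ i₂) ∧ not (j₁ ≡ᵇ j₂) ∧ marked x₁ ∧ marked x₂
        ∧ (val x₁ ≡ᵇ val x₂)))

isTableauᵇ : List (Box × Letter) → Bool
isTableauᵇ T = all (λ p → all (λ q → pairOK p q) T) T

countVal : ℕ → List Letter → ℕ
countVal v xs = length (filter (λ x → (val x ≡ᵇ v) ≟ᵇ true) xs)
  where
  open import Data.Bool using () renaming (_≟_ to _≟ᵇ_)

hasContentᵇ : List ℕ → List Letter → Bool
hasContentᵇ c xs = go 1 c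
  where
  go : ℕ → List ℕ → Bool
  go v [] = true
  go v (cᵥ ∷ cs) = (countVal v xs ≡ᵇ cᵥ) ∧ go (suc v) cs

-- Monomials x^c are encoded by finite exponent lists c = (c₁,…,c_m)
-- (trailing variables with exponent 0).  A tableau contributes to x^c
-- iff all its entries have value ≤ m and its content is c.
rCoeff : List ℕ → List ℕ → ℕ
rCoeff α c =
  length (filter (λ xs → (isTableauᵇ (zip (ribbon α) xs) ∧ hasContentᵇ c xs) ≟ᵇ true)
                 (fillings (length c) (length (ribbon α))))
  where
  open import Data.Bool using () renaming (_≟_ to _≟ᵇ_)

-- Power sums.  p_λ = ∏ p_{λ_i}, p_r = Σ_j x_j^r.  Expanding the product,
-- a term is a choice of a variable index j_i for each part; the coefficient
-- of x^c is the number of choices (j_i ∈ {1..m}) with Σ_{i : j_i = j} λ_i = c_j.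

assignments : ℕ → ℕ → List (List ℕ)
assignments m zero = [] ∷ []
assignments m (suc k) = concatMap (λ j → map (suc j ∷_) (assignments m k)) (upTo m)

weightAt : ℕ → List ℕ → List ℕ → ℕ
weightAt j (l ∷ ls) (a ∷ as) = (if a ≡ᵇ j then l else 0) + weightAt j ls as
weightAt j _ _ = 0

matchesᵇ : List ℕ → List ℕ → List ℕ → Bool
matchesᵇ λs c as = go 1 c
  where
  go : ℕ → List ℕ → Bool
  go j [] = true
  go j (cⱼ ∷ cs) = (weightAt j λs as ≡ᵇ cⱼ) ∧ go (suc j) cs

pCoeff : List ℕ → List ℕ → ℕ
pCoeff λs c =
  length (filter (λ as → matchesᵇ λs c as ≟ᵇ true) (assignments (length c) (length λs)))
  where
  open import Data.Bool using () renaming (_≟_ to _≟ᵇ_)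

data Decreasing : List ℕ → Set where
  []  : Decreasing []
  [_] : ∀ a → Decreasing (a ∷ [])
  _∷_ : ∀ {a b rest} → b ℕ.≤ a → Decreasing (b ∷ rest) → Decreasing (a ∷ b ∷ rest)

IsPartition : List ℕ → Set
IsPartition λs = All (λ a → 0 < a) λs × Decreasing λs

toℚ : ℕ → ℚ
toℚ n = + n ℚ./ 1

-- A symmetric function f, given by its monomial coefficients f(c) = [x^c] f,
-- is p-positive iff it equals a combination Σ a_λ p_λ with all a_λ ≥ 0
-- (the p_λ form a basis, so this is the same as the unique p-coefficients
-- being nonnegative; repeated λ in the list just add up).
PPositive : (List ℕ → ℕ) → Set
PPositive f =
  ∃ λ (L : List (List ℕ × ℚ)) →
    All (λ t → IsPartition (proj₁ t) × (0ℚ ℚ.≤ proj₂ t)) L ×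
    (∀ (c : List ℕ) →
       toℚ (f c) ≡ foldr (λ t acc → proj₂ t ℚ.* toℚ (pCoeff (proj₁ t) c) ℚ.+ acc) 0ℚ L)

𝔯 : List ℕ → (List ℕ → ℕ)
𝔯 α = rCoeff α

module Submission where

-- Let D be the ribbon of α = (1, rest), n = |D|, c = c(D), and
-- write r₀ = [x₁ⁿ] 𝔯_D, r₁ = [x₁ⁿ⁻¹ x₂] 𝔯_D.  Three estimates clash with 4c > n + 2:
--  (1) p-positivity gives r₁ ≤ n r₀: for every power sum p_λ the coefficient
--      of x₁ⁿ⁻¹x₂ is at most n times that of x₁ⁿ (a part of size one must go to
--      x₂), and the inequality survives nonnegative combinations;
--  (2) r₀ ≤ 2: a tableau with entries 1', 1 is forced everywhere except in the
--      bottom-left box;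
--  (3) 8c ≤ r₁ + 4: every corner T is a "site" (the rightmost box of a row
--      below the top one, with nothing below it); to a site we attach the
--      tableaux with a single 2 in T, in which T, the box above T and the
--      bottom-left box are free, so each family has 8 members (4 if T is the
--      bottom-left box); these families are disjoint because the 2 marks T.  Estimates (2) and (3) hold for every ribbon.

open import Defs
open import Data.Nat using (ℕ; zero; suc; _+_; _*_; _∸_; _≤_; _<_; z≤n; s≤s; _^_; pred; _≡ᵇ_; >-nonZero)
import Data.Nat as ℕ
open import Data.Nat.Properties
open import Algebra.Properties.CommutativeSemigroup +-commutativeSemigroup using (interchange)
open import Data.Nat.ListAction using (sum; product)
open import Data.Nat.Tactic.RingSolver using (solve-∀)
open import Data.Bool using (Bool; true; false; _∧_; _∨_; not; if_then_else_)
open import Data.Bool using () renaming (_≟_ to _≟ᵇ_)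
open import Data.Bool.Properties using (∧-identityʳ; ∨-zeroʳ; T-≡)
open import Data.Bool.ListAction using (all)
open import Data.List using (List; []; _∷_; _++_; map; concatMap; length; filter; zip; upTo; drop; replicate)
open import Data.List.Properties using (map-cong; length-++; length-map; length-upTo)
open import Data.List.Relation.Unary.All using (All; []; _∷_)
import Data.List.Relation.Unary.All as All
open import Data.List.Relation.Unary.Any using (here; there)
open import Data.List.Relation.Unary.Unique.Propositional using (Unique; []; _∷_)
import Data.List.Relation.Unary.Unique.Propositional.Properties as Unique
open import Data.List.Membership.Propositional using (_∈_)
open import Data.List.Membership.Propositional.Properties
  using (∈-upTo⁺; ∈-upTo⁻; ∈-++⁺ˡ; ∈-++⁺ʳ; ∈-++⁻; ∈-map⁺; ∈-map⁻; ∈-concat⁻′)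
open import Data.Product using (_×_; _,_; proj₁; proj₂; ∃)
open import Data.Sum using (_⊎_; inj₁; inj₂)
open import Data.Empty using (⊥; ⊥-elim)
open import Function using (case_of_; Equivalence)
open import Relation.Nullary using (¬_; yes; no)
open import Relation.Nullary.Decidable using (⌊_⌋; _×-dec_)
open import Relation.Binary.Definitions using (tri<; tri≈; tri>)
open import Relation.Binary.PropositionalEquality

private variable A B : Set

-- All coefficients in Defs are of the form length ∘ filter; `count` is the
-- structurally recursive version of that we reason with.
ind : Bool → ℕ
ind true = 1
ind false = 0

count : {A : Set} → (A → Bool) → List A → ℕ
count p [] = 0
count p (x ∷ xs) = ind (p x) + count p xs

count-filter : (p : A → Bool) (xs : List A) →
  length (filter (λ x → p x ≟ᵇ true) xs) ≡ count p xs
count-filter p [] = refl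
count-filter p (x ∷ xs) with p x
... | true = cong suc (count-filter p xs)
... | false = count-filter p xs

count-++ : (p : A → Bool) (xs ys : List A) → count p (xs ++ ys) ≡ count p xs + count p ys
count-++ p [] ys = refl
count-++ p (x ∷ xs) ys = trans (cong (ind (p x) +_) (count-++ p xs ys)) (sym (+-assoc (ind (p x)) _ _))

count-map : (p : B → Bool) (f : A → B) (xs : List A) → count p (map f xs) ≡ count (λ x → p (f x)) xs
count-map p f [] = refl
count-map p f (x ∷ xs) = cong (ind (p (f x)) +_) (count-map p f xs)

count-concatMap : (p : B → Bool) (f : A → List B) (xs : List A) →
  count p (concatMap f xs) ≡ sum (map (λ x → count p (f x)) xs)
count-concatMap p f [] = refl
count-concatMap p f (x ∷ xs) =
  trans (count-++ p (f x) (concatMap f xs)) (cong (count p (f x) +_) (count-concatMap p f xs))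

count-mono : (p q : A → Bool) (xs : List A) → (∀ x → x ∈ xs → p x ≡ true → q x ≡ true) → count p xs ≤ count q xs
count-mono p q [] h = z≤n
count-mono p q (x ∷ xs) h with p x in px | q x in qx
... | false | _ = +-mono-≤ z≤n (count-mono p q xs (λ y y∈ → h y (there y∈)))
... | true | true = s≤s (count-mono p q xs (λ y y∈ → h y (there y∈)))
... | true | false with () ← trans (sym qx) (h x (here refl) px)

count-cong : (p q : A → Bool) (xs : List A) → (∀ x → x ∈ xs → p x ≡ q x) → count p xs ≡ count q xs
count-cong p q [] h = refl
count-cong p q (x ∷ xs) h = cong₂ _+_ (cong ind (h x (here refl))) (count-cong p q xs (λ y y∈ → h y (there y∈)))

count-none : (p : A → Bool) (xs : List A) → (∀ x → x ∈ xs → p x ≡ false) → count p xs ≡ 0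
count-none p [] h = refl
count-none p (x ∷ xs) h rewrite h x (here refl) = count-none p xs (λ y y∈ → h y (there y∈))

count-const-∧ : (c : Bool) (p : A → Bool) (xs : List A) → count (λ x → c ∧ p x) xs ≡ ind c * count p xs
count-const-∧ true p xs = sym (+-identityʳ (count p xs))
count-const-∧ false p xs = count-none _ xs (λ _ _ → refl)

count-pos : (p : A → Bool) (xs : List A) (x : A) → x ∈ xs → p x ≡ true → 1 ≤ count p xs
count-pos p (y ∷ xs) x (here refl) px rewrite px = s≤s z≤n
count-pos p (y ∷ xs) x (there x∈) px = ≤-trans (count-pos p xs x x∈ px) (m≤n+m (count p xs) (ind (p y)))

count-witness : (p : A → Bool) (xs : List A) → 1 ≤ count p xs → ∃ λ x → x ∈ xs × p x ≡ true
count-witness p (x ∷ xs) pos with p x in px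
... | true = x , here refl , px
... | false with y , y∈ , py ← count-witness p xs pos = y , there y∈ , py

count-unique : (p : A → Bool) (c : A) → (∀ x → p x ≡ true → x ≡ c) →
  ∀ {xs} → Unique xs → count p xs ≤ 1
count-unique p c only-c {[]} [] = z≤n
count-unique p c only-c {x ∷ xs} (x∉xs ∷ u) with p x in px
... | false = count-unique p c only-c u
... | true = s≤s (≤-reflexive (count-none p xs others))
  where
  others : ∀ y → y ∈ xs → p y ≡ false
  others y y∈ with p y in py
  ... | false = refl
  ... | true = ⊥-elim (All.lookup x∉xs y∈ (trans (only-c x px) (sym (only-c y py))))

count-disjoint : (p q r : A → Bool) (xs : List A) →
  (∀ x → p x ≡ true → r x ≡ true) → (∀ x → q x ≡ true → r x ≡ true) →
  (∀ x → p x ≡ true → q x ≡ true → ⊥) →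
  count p xs + count q xs ≤ count r xs
count-disjoint p q r [] p⇒r q⇒r disjoint = z≤n
count-disjoint p q r (x ∷ xs) p⇒r q⇒r disjoint = begin
  ind (p x) + count p xs + (ind (q x) + count q xs) ≡⟨ interchange (ind (p x)) (count p xs) (ind (q x)) (count q xs) ⟩
  ind (p x) + ind (q x) + (count p xs + count q xs) ≤⟨ +-mono-≤ here-ok (count-disjoint p q r xs p⇒r q⇒r disjoint) ⟩
  ind (r x) + count r xs ∎
  where
  open ≤-Reasoning
  here-ok : ind (p x) + ind (q x) ≤ ind (r x)
  here-ok with p x in px | q x in qx
  ... | true | true = ⊥-elim (disjoint x px qx)
  ... | true | false rewrite p⇒r x px = ≤-refl
  ... | false | true rewrite q⇒r x qx = ≤-refl
  ... | false | false = z≤n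

sum-ind-* : (p : A → Bool) (k : ℕ) (xs : List A) → sum (map (λ x → ind (p x) * k) xs) ≡ count p xs * k
sum-ind-* p k [] = refl
sum-ind-* p k (x ∷ xs) =
  trans (cong (ind (p x) * k +_) (sum-ind-* p k xs)) (sym (*-distribʳ-+ k (ind (p x)) (count p xs)))

sum-+ : (f g : A → ℕ) (xs : List A) → sum (map (λ x → f x + g x) xs) ≡ sum (map f xs) + sum (map g xs)
sum-+ f g [] = refl
sum-+ f g (x ∷ xs) = trans (cong (f x + g x +_) (sum-+ f g xs)) (interchange (f x) (g x) _ _)

sum-mono : (f g : A → ℕ) (xs : List A) → (∀ x → x ∈ xs → f x ≤ g x) → sum (map f xs) ≤ sum (map g xs)
sum-mono f g [] h = z≤n
sum-mono f g (x ∷ xs) h = +-mono-≤ (h x (here refl)) (sum-mono f g xs (λ y y∈ → h y (there y∈)))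

double-count : (r : A → B → Bool) (q : B → Bool) (xs : List A) (ys : List B) →
  (∀ y → y ∈ ys → count (λ x → r x y) xs ≤ ind (q y)) → sum (map (λ x → count (r x) ys) xs) ≤ count q ys
double-count r q xs [] h = ≤-reflexive (no-pairs xs)
  where no-pairs : ∀ xs → sum (map (λ x → count (r x) []) xs) ≡ 0
        no-pairs [] = refl
        no-pairs (x ∷ xs) = no-pairs xs
double-count r q xs (y ∷ ys) h = begin
  sum (map (λ x → ind (r x y) + count (r x) ys) xs)
    ≡⟨ sum-+ (λ x → ind (r x y)) (λ x → count (r x) ys) xs ⟩
  sum (map (λ x → ind (r x y)) xs) + sum (map (λ x → count (r x) ys) xs)
    ≤⟨ +-mono-≤ (subst (_≤ ind (q y)) (sym (sum-ind (λ x → r x y) xs)) (h y (here refl)))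
                (double-count r q xs ys (λ z z∈ → h z (there z∈))) ⟩
  ind (q y) + count q ys ∎
  where
  open ≤-Reasoning
  sum-ind : (p : A → Bool) (xs : List A) → sum (map (λ x → ind (p x)) xs) ≡ count p xs
  sum-ind p [] = refl
  sum-ind p (x ∷ xs) = cong (ind (p x) +_) (sum-ind p xs)

≡ᵇ⇒≡′ : ∀ m n → (m ≡ᵇ n) ≡ true → m ≡ n
≡ᵇ⇒≡′ m n e = ≡ᵇ⇒≡ m n (Equivalence.from T-≡ e)

≡ᵇ-refl : ∀ m → (m ≡ᵇ m) ≡ true
≡ᵇ-refl zero = refl
≡ᵇ-refl (suc m) = ≡ᵇ-refl m

≢⇒≡ᵇ-false : ∀ m n → ¬ m ≡ n → (m ≡ᵇ n) ≡ false
≢⇒≡ᵇ-false m n m≢n with m ≡ᵇ n in e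
... | true = ⊥-elim (m≢n (≡ᵇ⇒≡′ m n e))
... | false = refl

∧-true-l : ∀ {a b} → a ∧ b ≡ true → a ≡ true
∧-true-l {true} _ = refl

∧-true-r : ∀ {a b} → a ∧ b ≡ true → b ≡ true
∧-true-r {true} e = e

∧-intro : ∀ {a b} → a ≡ true → b ≡ true → a ∧ b ≡ true
∧-intro refl refl = refl

∨-introˡ : ∀ {a b} → a ≡ true → a ∨ b ≡ true
∨-introˡ refl = refl

∨-introʳ : ∀ a {b} → b ≡ true → a ∨ b ≡ true
∨-introʳ true _ = refl
∨-introʳ false e = e

not-true⇒false : ∀ {a} → not a ≡ true → a ≡ false
not-true⇒false {false} _ = refl

≡ᵇ-false⇒≢ : ∀ m n → (m ≡ᵇ n) ≡ false → ¬ m ≡ n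
≡ᵇ-false⇒≢ m .m e refl with () ← trans (sym e) (≡ᵇ-refl m)

implies : ∀ {a b} → (a ≡ true → b ≡ true) → (not a ∨ b) ≡ true
implies {true} h = h refl
implies {false} h = refl

refute : ∀ {a} → ¬ a ≡ true → not a ≡ true
refute {true} h = ⊥-elim (h refl)
refute {false} h = refl

box≡ᵇ⇒≡ : ∀ b c → box≡ᵇ b c ≡ true → b ≡ c
box≡ᵇ⇒≡ (i , j) (k , l) e = cong₂ _,_ (≡ᵇ⇒≡′ i k (∧-true-l e)) (≡ᵇ⇒≡′ j l (∧-true-r {i ≡ᵇ k} e))

box≡ᵇ-refl : ∀ b → box≡ᵇ b b ≡ true
box≡ᵇ-refl (i , j) rewrite ≡ᵇ-refl i | ≡ᵇ-refl j = refl

box≢⇒false : ∀ b c → ¬ b ≡ c → box≡ᵇ b c ≡ false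
box≢⇒false b c b≢c with box≡ᵇ b c in e
... | true = ⊥-elim (b≢c (box≡ᵇ⇒≡ b c e))
... | false = refl

memᵇ-sound : ∀ b bs → memᵇ b bs ≡ true → b ∈ bs
memᵇ-sound b (c ∷ bs) e with box≡ᵇ b c in bc
... | true = here (box≡ᵇ⇒≡ b c bc)
... | false = there (memᵇ-sound b bs e)

memᵇ-complete : ∀ b bs → b ∈ bs → memᵇ b bs ≡ true
memᵇ-complete b (c ∷ bs) (here refl) rewrite box≡ᵇ-refl b = refl
memᵇ-complete b (c ∷ bs) (there b∈) rewrite memᵇ-complete b bs b∈ = ∨-zeroʳ (box≡ᵇ b c)

-- Row k of the ribbon t (rows counted from 0 at the top) occupies the columns
-- start t k , … , start t k + width t k ∸ 1.
headOr0 : List ℕ → ℕ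
headOr0 [] = 0
headOr0 (a ∷ _) = a

start width : List ℕ → ℕ → ℕ
start t k = topStart (drop k t)
width t k = headOr0 (drop k t)

topRowBoxes : ℕ → ℕ → List ℕ → List Box
topRowBoxes i₀ a t = map (λ k → (i₀ , topStart (a ∷ t) + k)) (upTo a)

∈boxes⇒ : ∀ i₀ t i j → (i , j) ∈ boxesFrom i₀ t →
  ∃ λ k → k < length t × i ≡ i₀ + k × start t k ≤ j × j < start t k + width t k
∈boxes⇒ i₀ (a ∷ t) i j p with ∈-++⁻ (topRowBoxes i₀ a t) p
... | inj₁ q with m , m∈ , refl ← ∈-map⁻ (λ k → (i₀ , topStart (a ∷ t) + k)) q =
  0 , s≤s z≤n , sym (+-identityʳ i₀) , m≤m+n _ m , +-monoʳ-< (topStart (a ∷ t)) (∈-upTo⁻ m∈)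
... | inj₂ q with k , k< , i≡ , lo , hi ← ∈boxes⇒ (suc i₀) t i j q =
  suc k , s≤s k< , trans i≡ (sym (+-suc i₀ k)) , lo , hi

∈boxes⇐ : ∀ i₀ t k j → k < length t → start t k ≤ j → j < start t k + width t k →
  (i₀ + k , j) ∈ boxesFrom i₀ t
∈boxes⇐ i₀ (a ∷ t) zero j _ lo hi = ∈-++⁺ˡ (subst (_∈ topRowBoxes i₀ a t) box≡ (∈-map⁺ _ offset∈))
  where
  s : ℕ
  s = topStart (a ∷ t)
  box≡ : (i₀ , s + (j ∸ s)) ≡ (i₀ + 0 , j)
  box≡ = cong₂ _,_ (sym (+-identityʳ i₀)) (m+[n∸m]≡n lo)
  offset∈ : j ∸ s ∈ upTo a
  offset∈ = ∈-upTo⁺ (+-cancelˡ-< s _ _ (subst (_< s + a) (sym (m+[n∸m]≡n lo)) hi))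
∈boxes⇐ i₀ (a ∷ t) (suc k) j (s≤s k<) lo hi =
  ∈-++⁺ʳ _ (subst (λ i → (i , j) ∈ boxesFrom (suc i₀) t) (sym (+-suc i₀ k)) (∈boxes⇐ (suc i₀) t k j k< lo hi))

length-boxes : ∀ i₀ t → length (boxesFrom i₀ t) ≡ sum t
length-boxes i₀ [] = refl
length-boxes i₀ (a ∷ t) = begin
  length (topRowBoxes i₀ a t ++ boxesFrom (suc i₀) t)
    ≡⟨ length-++ (topRowBoxes i₀ a t) ⟩
  length (topRowBoxes i₀ a t) + length (boxesFrom (suc i₀) t)
    ≡⟨ cong₂ _+_ (trans (length-map _ (upTo a)) (length-upTo a)) (length-boxes (suc i₀) t) ⟩
  a + sum t ∎
  where open ≡-Reasoning

boxes-once : ∀ i₀ t c → count (λ b → box≡ᵇ b c) (boxesFrom i₀ t) ≤ 1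
boxes-once i₀ [] c = z≤n
boxes-once i₀ (a ∷ t) (ci , cj) with i₀ ≡ᵇ ci in i₀≡ci
... | true = begin
  count p (boxesFrom i₀ (a ∷ t))
    ≡⟨ count-++ p (topRowBoxes i₀ a t) _ ⟩
  count p (topRowBoxes i₀ a t) + count p (boxesFrom (suc i₀) t)
    ≡⟨ cong (count p (topRowBoxes i₀ a t) +_) (count-none p _ lowerRows) ⟩
  count p (topRowBoxes i₀ a t) + 0
    ≤⟨ +-monoˡ-≤ 0 (count-unique p (ci , cj) (λ b → box≡ᵇ⇒≡ b (ci , cj))
                     (Unique.map⁺ (λ e → +-cancelˡ-≡ (topStart (a ∷ t)) _ _ (cong proj₂ e)) (Unique.upTo⁺ a))) ⟩
  1 ∎
  where
  open ≤-Reasoning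
  p : Box → Bool
  p b = box≡ᵇ b (ci , cj)
  lowerRows : ∀ b → b ∈ boxesFrom (suc i₀) t → box≡ᵇ b (ci , cj) ≡ false
  lowerRows (i , j) b∈ with k , _ , i≡ , _ ← ∈boxes⇒ (suc i₀) t i j b∈ =
    box≢⇒false (i , j) (ci , cj) (λ e → <-irrefl (trans (≡ᵇ⇒≡′ i₀ ci i₀≡ci) (trans (sym (cong proj₁ e)) i≡))
                                                  (s≤s (m≤m+n i₀ k)))
... | false = begin
  count p (boxesFrom i₀ (a ∷ t))
    ≡⟨ count-++ p (topRowBoxes i₀ a t) _ ⟩
  count p (topRowBoxes i₀ a t) + count p (boxesFrom (suc i₀) t)
    ≡⟨ cong (_+ count p (boxesFrom (suc i₀) t)) (count-none p _ otherRow) ⟩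
  count p (boxesFrom (suc i₀) t)
    ≤⟨ boxes-once (suc i₀) t (ci , cj) ⟩
  1 ∎
  where
  open ≤-Reasoning
  p : Box → Bool
  p b = box≡ᵇ b (ci , cj)
  otherRow : ∀ b → b ∈ topRowBoxes i₀ a t → box≡ᵇ b (ci , cj) ≡ false
  otherRow b b∈ with k , _ , refl ← ∈-map⁻ (λ k → (i₀ , topStart (a ∷ t) + k)) b∈ rewrite i₀≡ci = refl

-- The geometry of the connected ribbon D of a composition α: row k+1 (k from 0)
-- occupies columns S k … E k, and the leftmost box of each row sits on top of
-- the rightmost box of the next row.
module Ribbon (α : List ℕ) (pos : All (0 <_) α) where

  ℓ : ℕ
  ℓ = length α

  D : List Box
  D = ribbon α

  S W E : ℕ → ℕ
  S = start α
  W = width α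
  E k = S k + W k ∸ 1

  ∈D⇒ : ∀ i j → (i , j) ∈ D → ∃ λ k → k < ℓ × i ≡ suc k × S k ≤ j × j < S k + W k
  ∈D⇒ = ∈boxes⇒ 1 α

  ∈D⇐ : ∀ k j → k < ℓ → S k ≤ j → j < S k + W k → (suc k , j) ∈ D
  ∈D⇐ = ∈boxes⇐ 1 α

  size-D : length D ≡ size α
  size-D = length-boxes 1 α

  D-once : ∀ c → count (λ b → box≡ᵇ b c) D ≤ 1
  D-once = boxes-once 1 α

  W-pos : ∀ k → k < ℓ → 0 < W k
  W-pos k = go α pos k
    where
    go : ∀ t → All (0 <_) t → ∀ k → k < length t → 0 < width t k
    go (a ∷ t) (a>0 ∷ _) zero _ = a>0
    go (a ∷ t) (_ ∷ ps) (suc k) (s≤s k<) = go t ps k k<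

  S≡E : ∀ k → suc k < ℓ → S k ≡ E (suc k)
  S≡E k = go α k
    where
    go : ∀ t k → suc k < length t → start t k ≡ start t (suc k) + width t (suc k) ∸ 1
    go (a ∷ b ∷ t) zero _ = refl
    go (a ∷ t) (suc k) (s≤s k<) = go t k k<

  S≤E : ∀ k → k < ℓ → S k ≤ E k
  S≤E k k< with W k | W-pos k k<
  ... | suc w | _ = subst (S k ≤_) (sym (+-∸-assoc (S k) (s≤s (z≤n {w})))) (m≤m+n (S k) w)

  suc-E : ∀ k → k < ℓ → suc (E k) ≡ S k + W k
  suc-E k k< with W k | W-pos k k<
  ... | suc w | _ rewrite +-suc (S k) w = refl

  start∈D : ∀ k → k < ℓ → (suc k , S k) ∈ D
  start∈D k k< = ∈D⇐ k (S k) k< ≤-refl (m<m+n (S k) (W-pos k k<))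

  end∈D : ∀ k → k < ℓ → (suc k , E k) ∈ D
  end∈D k k< = ∈D⇐ k (E k) k< (S≤E k k<) (≤-reflexive (suc-E k k<))

  below-start∈D : ∀ k → suc k < ℓ → (suc (suc k) , S k) ∈ D
  below-start∈D k k< = subst (λ j → (suc (suc k) , j) ∈ D) (sym (S≡E k k<)) (end∈D (suc k) k<)

  S-antitone : ∀ k k′ → k ≤ k′ → k′ < ℓ → S k′ ≤ S k
  S-antitone k k′ k≤k′ k′< =
    subst (λ m → S m ≤ S k) (m+[n∸m]≡n k≤k′) (go (k′ ∸ k) (subst (_< ℓ) (sym (m+[n∸m]≡n k≤k′)) k′<))
    where
    go : ∀ d → k + d < ℓ → S (k + d) ≤ S k
    go zero k< rewrite +-identityʳ k = ≤-refl
    go (suc d) k< rewrite +-suc k d =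
      ≤-trans (≤-trans (S≤E (suc (k + d)) k<) (≤-reflexive (sym (S≡E (k + d) k<)))) (go d (<-trans (n<1+n (k + d)) k<))

  same-column : ∀ au al j → (suc au , j) ∈ D → (suc al , j) ∈ D → au < al →
    (j ≡ S au) × (j ≡ E al) × (j ≡ S (pred al))
  same-column au (suc al′) j up∈ low∈ (s≤s au≤al′)
    with _ , _ , refl , Sau≤j , _ ← ∈D⇒ _ _ up∈ | _ , al< , refl , _ , j<end ← ∈D⇒ _ _ low∈ =
    j≡Sau , trans j≡Sal′ (S≡E al′ al<) , j≡Sal′
    where
    j≤Sal′ : j ≤ S al′
    j≤Sal′ = subst (j ≤_) (trans (pred[m∸n]≡m∸[1+n] (S (suc al′) + W (suc al′)) 0) (sym (S≡E al′ al<)))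
                   (<⇒≤pred j<end)
    Sal′≤Sau : S al′ ≤ S au
    Sal′≤Sau = S-antitone au al′ au≤al′ (<-trans (n<1+n al′) al<)
    j≡Sau : j ≡ S au
    j≡Sau = ≤-antisym (≤-trans j≤Sal′ Sal′≤Sau) Sau≤j
    j≡Sal′ : j ≡ S al′
    j≡Sal′ = ≤-antisym j≤Sal′ (≤-trans Sal′≤Sau Sau≤j)

  E≤S⇒W≤1 : ∀ k → E k ≤ S k → W k ≤ 1
  E≤S⇒W≤1 k E≤S with W k
  ... | zero = z≤n
  ... | suc zero = ≤-refl
  ... | suc (suc w) rewrite +-suc (S k) (suc w) = ⊥-elim (<-irrefl refl (<-≤-trans (m<m+n (S k) (s≤s z≤n)) E≤S))

  BL : Box
  BL = (ℓ , S (pred ℓ))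

  BL∈D : 0 < ℓ → BL ∈ D
  BL∈D ℓ>0 =
    subst (λ i → (i , S (pred ℓ)) ∈ D) suc-pred-ℓ (start∈D (pred ℓ) (subst (pred ℓ <_) suc-pred-ℓ (n<1+n (pred ℓ))))
    where
    suc-pred-ℓ : suc (pred ℓ) ≡ ℓ
    suc-pred-ℓ = suc-pred ℓ {{>-nonZero ℓ>0}}

  W≤1⇒E≡S : ∀ k → k < ℓ → W k ≤ 1 → E k ≡ S k
  W≤1⇒E≡S k k< W≤1 with W k | W-pos k k<
  ... | suc zero | _ = m+n∸n≡m (S k) 1
  ... | suc (suc _) | _ with s≤s () ← W≤1

respects : (Box → Letter → Bool) → List Box → List Letter → Bool
respects A [] [] = true
respects A (b ∷ bs) (x ∷ xs) = A b x ∧ respects A bs xs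
respects A _ _ = false

count-respecting : ∀ m (A : Box → Letter → Bool) bs →
  count (respects A bs) (fillings m (length bs)) ≡ product (map (λ b → count (A b) (letters m)) bs)
count-respecting m A [] = refl
count-respecting m A (b ∷ bs) = begin
  count (respects A (b ∷ bs)) (concatMap (λ x → map (x ∷_) rest) (letters m))
    ≡⟨ count-concatMap _ (λ x → map (x ∷_) rest) (letters m) ⟩
  sum (map (λ x → count (respects A (b ∷ bs)) (map (x ∷_) rest)) (letters m))
    ≡⟨ cong sum (map-cong (λ x → trans (count-map (respects A (b ∷ bs)) (x ∷_) rest)
                                        (count-const-∧ (A b x) (respects A bs) rest)) (letters m)) ⟩
  sum (map (λ x → ind (A b x) * count (respects A bs) rest) (letters m))
    ≡⟨ sum-ind-* (A b) _ (letters m) ⟩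
  count (A b) (letters m) * count (respects A bs) rest
    ≡⟨ cong (count (A b) (letters m) *_) (count-respecting m A bs) ⟩
  count (A b) (letters m) * product (map (λ b → count (A b) (letters m)) bs) ∎
  where
  open ≡-Reasoning
  rest : List (List Letter)
  rest = fillings m (length bs)

product-one-or-two : (two : A → Bool) (xs : List A) →
  product (map (λ b → suc (ind (two b))) xs) ≡ 2 ^ count two xs
product-one-or-two two [] = refl
product-one-or-two two (x ∷ xs) with two x
... | true = cong (2 *_) (product-one-or-two two xs)
... | false = trans (+-identityʳ _) (product-one-or-two two xs)

fillings-shape : ∀ m k xs → xs ∈ fillings m k → length xs ≡ k × All (_∈ letters m) xs
fillings-shape m zero .[] (here refl) = refl , []
fillings-shape m (suc k) xs xs∈
  with ys , xs∈′ , ys∈ ← ∈-concat⁻′ (map (λ x → map (x ∷_) (fillings m k)) (letters m)) xs∈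
  with x , x∈ , refl ← ∈-map⁻ (λ x → map (x ∷_) (fillings m k)) ys∈
  with zs , zs∈ , refl ← ∈-map⁻ (x ∷_) xs∈′
  with len , lets ← fillings-shape m k zs zs∈ = cong suc len , (x∈ ∷ lets)

zip-box∈ : ∀ (bs : List Box) (xs : List Letter) b x → (b , x) ∈ zip bs xs → b ∈ bs
zip-box∈ (c ∷ bs) (y ∷ xs) b x (here refl) = here refl
zip-box∈ (c ∷ bs) (y ∷ xs) b x (there p) = there (zip-box∈ bs xs b x p)

zip-letter∈ : ∀ (bs : List Box) (xs : List Letter) b x → (b , x) ∈ zip bs xs → x ∈ xs
zip-letter∈ (c ∷ bs) (y ∷ xs) b x (here refl) = here refl
zip-letter∈ (c ∷ bs) (y ∷ xs) b x (there p) = there (zip-letter∈ bs xs b x p)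

zip-complete : ∀ (bs : List Box) (xs : List Letter) → length xs ≡ length bs → ∀ b → b ∈ bs →
  ∃ λ x → (b , x) ∈ zip bs xs
zip-complete (c ∷ bs) (y ∷ xs) len b (here refl) = y , here refl
zip-complete (c ∷ bs) (y ∷ xs) len b (there b∈) with x , p ← zip-complete bs xs (suc-injective len) b b∈ = x , there p

respects⇒ : ∀ A bs xs → respects A bs xs ≡ true → ∀ b x → (b , x) ∈ zip bs xs → A b x ≡ true
respects⇒ A (c ∷ bs) (y ∷ xs) e b x (here refl) = ∧-true-l e
respects⇒ A (c ∷ bs) (y ∷ xs) e b x (there p) = respects⇒ A bs xs (∧-true-r {A c y} e) b x p

respects⇐ : ∀ A bs xs → length xs ≡ length bs → (∀ b x → (b , x) ∈ zip bs xs → A b x ≡ true) →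
  respects A bs xs ≡ true
respects⇐ A [] [] len h = refl
respects⇐ A (c ∷ bs) (y ∷ xs) len h =
  ∧-intro (h c y (here refl)) (respects⇐ A bs xs (suc-injective len) (λ b x p → h b x (there p)))

all⇒ : (p : A → Bool) (xs : List A) → all p xs ≡ true → ∀ x → x ∈ xs → p x ≡ true
all⇒ p (y ∷ xs) e x (here refl) = ∧-true-l e
all⇒ p (y ∷ xs) e x (there x∈) = all⇒ p xs (∧-true-r {p y} e) x x∈

all⇐ : (p : A → Bool) (xs : List A) → (∀ x → x ∈ xs → p x ≡ true) → all p xs ≡ true
all⇐ p [] h = refl
all⇐ p (y ∷ xs) h = ∧-intro (h y (here refl)) (all⇐ p xs (λ x x∈ → h x (there x∈)))

pairOK-intro : ∀ i₁ j₁ i₂ j₂ (x₁ x₂ : Letter) →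
  (i₁ ≡ i₂ → j₂ ≡ suc j₁ → (x₁ ≤Lᵇ x₂) ≡ true) →
  (j₁ ≡ j₂ → i₂ ≡ suc i₁ → (x₁ ≤Lᵇ x₂) ≡ true) →
  (j₁ ≡ j₂ → ¬ i₁ ≡ i₂ → marked x₁ ≡ false → marked x₂ ≡ false → val x₁ ≡ val x₂ → ⊥) →
  (i₁ ≡ i₂ → ¬ j₁ ≡ j₂ → marked x₁ ≡ true → marked x₂ ≡ true → val x₁ ≡ val x₂ → ⊥) →
  pairOK ((i₁ , j₁) , x₁) ((i₂ , j₂) , x₂) ≡ true
pairOK-intro i₁ j₁ i₂ j₂ (v₁ , m₁) (v₂ , m₂) row col unmarked primed =
  ∧-intro (implies λ e → row (≡ᵇ⇒≡′ i₁ i₂ (∧-true-l e)) (≡ᵇ⇒≡′ j₂ (suc j₁) (∧-true-r {i₁ ≡ᵇ i₂} e))) (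
  ∧-intro (implies λ e → col (≡ᵇ⇒≡′ j₁ j₂ (∧-true-l e)) (≡ᵇ⇒≡′ i₂ (suc i₁) (∧-true-r {j₁ ≡ᵇ j₂} e))) (
  ∧-intro (refute λ e → let e₂ = ∧-true-r {j₁ ≡ᵇ j₂} e ; e₃ = ∧-true-r {not (i₁ ≡ᵇ i₂)} e₂
                            e₄ = ∧-true-r {not m₁} e₃ ; e₅ = ∧-true-r {not m₂} e₄ in
    unmarked (≡ᵇ⇒≡′ j₁ j₂ (∧-true-l e)) (≡ᵇ-false⇒≢ i₁ i₂ (not-true⇒false (∧-true-l e₂)))
             (not-true⇒false (∧-true-l e₃)) (not-true⇒false (∧-true-l e₄)) (≡ᵇ⇒≡′ v₁ v₂ e₅))
          (refute λ e → let e₂ = ∧-true-r {i₁ ≡ᵇ i₂} e ; e₃ = ∧-true-r {not (j₁ ≡ᵇ j₂)} e₂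
                            e₄ = ∧-true-r {m₁} e₃ ; e₅ = ∧-true-r {m₂} e₄ in
    primed (≡ᵇ⇒≡′ i₁ i₂ (∧-true-l e)) (≡ᵇ-false⇒≢ j₁ j₂ (not-true⇒false (∧-true-l e₂)))
           (∧-true-l e₃) (∧-true-l e₄) (≡ᵇ⇒≡′ v₁ v₂ e₅))))

pairOK-row : ∀ i j (x₁ x₂ : Letter) → pairOK ((i , j) , x₁) ((i , suc j) , x₂) ≡ true →
  (x₁ ≤Lᵇ x₂) ≡ true × (marked x₁ ∧ marked x₂ ∧ (val x₁ ≡ᵇ val x₂)) ≡ false
pairOK-row i j (v₁ , m₁) (v₂ , m₂) e
  rewrite ≡ᵇ-refl i | ≡ᵇ-refl j | ≢⇒≡ᵇ-false j (suc j) (λ q → <-irrefl q (n<1+n j)) =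
  ∧-true-l e ,
  not-true⇒false (∧-true-r {not false}
                   (∧-true-r {not (false ∧ (i ≡ᵇ suc i)) ∨ ((v₁ , m₁) ≤Lᵇ (v₂ , m₂))}
                     (∧-true-r {(v₁ , m₁) ≤Lᵇ (v₂ , m₂)} e)))

pairOK-col : ∀ i j (x₁ x₂ : Letter) → pairOK ((i , j) , x₁) ((suc i , j) , x₂) ≡ true →
  (x₁ ≤Lᵇ x₂) ≡ true × (not (marked x₁) ∧ not (marked x₂) ∧ (val x₁ ≡ᵇ val x₂)) ≡ false
pairOK-col i j (v₁ , m₁) (v₂ , m₂) e
  rewrite ≡ᵇ-refl i | ≡ᵇ-refl j | ≢⇒≡ᵇ-false i (suc i) (λ q → <-irrefl q (n<1+n i)) =
  ∧-true-l (∧-true-r {not (false ∧ (suc i ≡ᵇ suc j)) ∨ ((v₁ , m₁) ≤Lᵇ (v₂ , m₂))} e) ,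
  not-true⇒false (∧-true-l (∧-true-r {(v₁ , m₁) ≤Lᵇ (v₂ , m₂)}
                              (∧-true-r {not (false ∧ (suc i ≡ᵇ suc j)) ∨ ((v₁ , m₁) ≤Lᵇ (v₂ , m₂))} e)))

count-zip-letters : (f : Letter → Bool) (bs : List Box) (xs : List Letter) → length xs ≡ length bs →
  count f xs ≡ count (λ p → f (proj₂ p)) (zip bs xs)
count-zip-letters f [] [] len = refl
count-zip-letters f (b ∷ bs) (x ∷ xs) len = cong (ind (f x) +_) (count-zip-letters f bs xs (suc-injective len))

count-zip-boxes : (g : Box → Bool) (bs : List Box) (xs : List Letter) → length xs ≡ length bs →
  count g bs ≡ count (λ p → g (proj₁ p)) (zip bs xs)
count-zip-boxes g [] [] len = refl
count-zip-boxes g (b ∷ bs) (x ∷ xs) len = cong (ind (g b) +_) (count-zip-boxes g bs xs (suc-injective len))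

values-1-2 : ∀ xs → All (_∈ letters 2) xs → count (λ x → val x ≡ᵇ 1) xs + count (λ x → val x ≡ᵇ 2) xs ≡ length xs
values-1-2 [] [] = refl
values-1-2 (x ∷ xs) (here refl ∷ lets) = cong suc (values-1-2 xs lets)
values-1-2 (x ∷ xs) (there (here refl) ∷ lets) = cong suc (values-1-2 xs lets)
values-1-2 (x ∷ xs) (there (there (here refl)) ∷ lets) = trans (+-suc _ _) (cong suc (values-1-2 xs lets))
values-1-2 (x ∷ xs) (there (there (there (here refl))) ∷ lets) = trans (+-suc _ _) (cong suc (values-1-2 xs lets))

assignments-one : ∀ k → assignments 1 k ≡ replicate k 1 ∷ []
assignments-one zero = refl
assignments-one (suc k) rewrite assignments-one k = refl

weight-all-first : ∀ ls → weightAt 1 ls (replicate (length ls) 1) ≡ sum ls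
weight-all-first [] = refl
weight-all-first (l ∷ ls) = cong (l +_) (weight-all-first ls)

pCoeff-one : ∀ ls a → pCoeff ls (a ∷ []) ≡ ind (sum ls ≡ᵇ a)
pCoeff-one ls a = begin
  pCoeff ls (a ∷ [])
    ≡⟨ count-filter (matchesᵇ ls (a ∷ [])) (assignments 1 (length ls)) ⟩
  count (matchesᵇ ls (a ∷ [])) (assignments 1 (length ls))
    ≡⟨ cong (count (matchesᵇ ls (a ∷ []))) (assignments-one (length ls)) ⟩
  ind ((weightAt 1 ls (replicate (length ls) 1) ≡ᵇ a) ∧ true) + 0
    ≡⟨ +-identityʳ _ ⟩
  ind ((weightAt 1 ls (replicate (length ls) 1) ≡ᵇ a) ∧ true)
    ≡⟨ cong ind (∧-identityʳ _) ⟩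
  ind (weightAt 1 ls (replicate (length ls) 1) ≡ᵇ a)
    ≡⟨ cong (λ w → ind (w ≡ᵇ a)) (weight-all-first ls) ⟩
  ind (sum ls ≡ᵇ a) ∎
  where open ≡-Reasoning

distributions : List ℕ → (ℕ → ℕ → Bool) → ℕ
distributions ls P = count (λ as → P (weightAt 1 ls as) (weightAt 2 ls as)) (assignments 2 (length ls))

-- the first part goes either to x₁ or to x₂
distributions-∷ : ∀ l ls P → distributions (l ∷ ls) P ≡
  distributions ls (λ x y → P (l + x) y) + distributions ls (λ x y → P x (l + y))
distributions-∷ l ls P = begin
  count f (map (1 ∷_) rest ++ map (2 ∷_) rest ++ [])
    ≡⟨ count-++ f (map (1 ∷_) rest) _ ⟩
  count f (map (1 ∷_) rest) + count f (map (2 ∷_) rest ++ [])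
    ≡⟨ cong (count f (map (1 ∷_) rest) +_) (trans (count-++ f (map (2 ∷_) rest) []) (+-identityʳ _)) ⟩
  count f (map (1 ∷_) rest) + count f (map (2 ∷_) rest)
    ≡⟨ cong₂ _+_ (count-map f (1 ∷_) rest) (count-map f (2 ∷_) rest) ⟩
  distributions ls (λ x y → P (l + x) y) + distributions ls (λ x y → P x (l + y)) ∎
  where
  open ≡-Reasoning
  rest : List (List ℕ)
  rest = assignments 2 (length ls)
  f : List ℕ → Bool
  f as = P (weightAt 1 (l ∷ ls) as) (weightAt 2 (l ∷ ls) as)

distributions-mono : ∀ ls P Q → (∀ x y → P x y ≡ true → Q x y ≡ true) → distributions ls P ≤ distributions ls Q
distributions-mono ls P Q P⇒Q = count-mono _ _ (assignments 2 (length ls)) (λ as _ → P⇒Q _ _)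

distributions-never : ∀ ls P → (∀ x y → P x y ≡ false) → distributions ls P ≡ 0
distributions-never ls P never = count-none _ (assignments 2 (length ls)) (λ as _ → never _ _)

all-to-first : ∀ ls → All (0 <_) ls → ∀ Q → distributions ls (λ x y → (y ≡ᵇ 0) ∧ Q x) ≤ ind (Q (sum ls))
all-to-first [] [] Q = ≤-reflexive (+-identityʳ (ind (Q 0)))
all-to-first (suc l ∷ ls) (_ ∷ ps) Q = begin
  distributions (suc l ∷ ls) (λ x y → (y ≡ᵇ 0) ∧ Q x)
    ≡⟨ distributions-∷ (suc l) ls (λ x y → (y ≡ᵇ 0) ∧ Q x) ⟩
  distributions ls (λ x y → (y ≡ᵇ 0) ∧ Q (suc l + x)) + distributions ls (λ x y → false ∧ Q x)
    ≡⟨ cong (distributions ls (λ x y → (y ≡ᵇ 0) ∧ Q (suc l + x)) +_) (distributions-never ls _ (λ _ _ → refl)) ⟩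
  distributions ls (λ x y → (y ≡ᵇ 0) ∧ Q (suc l + x)) + 0
    ≤⟨ +-monoˡ-≤ 0 (all-to-first ls ps (λ x → Q (suc l + x))) ⟩
  ind (Q (suc l + sum ls)) + 0
    ≡⟨ +-identityʳ _ ⟩
  ind (Q (suc l + sum ls)) ∎
  where open ≤-Reasoning

-- With positive parts, x₂ has weight 1 only if a single part of size 1 goes to
-- x₂, so there are at most (number of parts) such distributions.
one-to-second : ∀ ls → All (0 <_) ls → ∀ Q →
  distributions ls (λ x y → (y ≡ᵇ 1) ∧ Q (suc x)) ≤ length ls * ind (Q (sum ls))
one-to-second [] [] Q = z≤n
one-to-second (l ∷ ls) (l>0 ∷ ps) Q = begin
  distributions (l ∷ ls) (λ x y → (y ≡ᵇ 1) ∧ Q (suc x))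
    ≡⟨ distributions-∷ l ls (λ x y → (y ≡ᵇ 1) ∧ Q (suc x)) ⟩
  distributions ls (λ x y → (y ≡ᵇ 1) ∧ Q (suc (l + x))) + distributions ls (λ x y → (l + y ≡ᵇ 1) ∧ Q (suc x))
    ≤⟨ +-mono-≤ first-stays (second-takes l l>0) ⟩
  length ls * ind (Q (l + sum ls)) + ind (Q (l + sum ls))
    ≡⟨ +-comm (length ls * ind (Q (l + sum ls))) _ ⟩
  suc (length ls) * ind (Q (l + sum ls)) ∎
  where
  open ≤-Reasoning
  first-stays : distributions ls (λ x y → (y ≡ᵇ 1) ∧ Q (suc (l + x))) ≤ length ls * ind (Q (l + sum ls))
  first-stays = ≤-trans
    (distributions-mono ls _ (λ x y → (y ≡ᵇ 1) ∧ Q (l + suc x))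
                            (λ x y → subst (λ z → (y ≡ᵇ 1) ∧ Q z ≡ true) (sym (+-suc l x))))
    (one-to-second ls ps (λ z → Q (l + z)))
  second-takes : ∀ l → 0 < l → distributions ls (λ x y → (l + y ≡ᵇ 1) ∧ Q (suc x)) ≤ ind (Q (l + sum ls))
  second-takes (suc zero) _ = all-to-first ls ps (λ x → Q (suc x))
  second-takes (suc (suc l)) _ = ≤-trans (≤-reflexive (distributions-never ls _ (λ _ _ → refl))) z≤n

len≤sum : ∀ ls → All (0 <_) ls → length ls ≤ sum ls
len≤sum [] [] = z≤n
len≤sum (l ∷ ls) (l>0 ∷ ps) = +-mono-≤ l>0 (len≤sum ls ps)

pCoeff-hook-bound : ∀ a ls → All (0 <_) ls → pCoeff ls (a ∷ 1 ∷ []) ≤ suc a * pCoeff ls (suc a ∷ [])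
pCoeff-hook-bound a ls ps = begin
  pCoeff ls (a ∷ 1 ∷ [])
    ≡⟨ count-filter (matchesᵇ ls (a ∷ 1 ∷ [])) (assignments 2 (length ls)) ⟩
  distributions ls (λ x y → (x ≡ᵇ a) ∧ ((y ≡ᵇ 1) ∧ true))
    ≤⟨ distributions-mono ls (λ x y → (x ≡ᵇ a) ∧ ((y ≡ᵇ 1) ∧ true))
                             (λ x y → (y ≡ᵇ 1) ∧ (suc x ≡ᵇ suc a)) swap ⟩
  distributions ls (λ x y → (y ≡ᵇ 1) ∧ (suc x ≡ᵇ suc a))
    ≤⟨ one-to-second ls ps (_≡ᵇ suc a) ⟩
  length ls * ind (sum ls ≡ᵇ suc a)
    ≤⟨ parts-bound ⟩
  suc a * ind (sum ls ≡ᵇ suc a)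
    ≡⟨ cong (suc a *_) (sym (pCoeff-one ls (suc a))) ⟩
  suc a * pCoeff ls (suc a ∷ []) ∎
  where
  open ≤-Reasoning
  swap : ∀ x y → (x ≡ᵇ a) ∧ ((y ≡ᵇ 1) ∧ true) ≡ true → (y ≡ᵇ 1) ∧ (x ≡ᵇ a) ≡ true
  swap x y e = ∧-intro (∧-true-l {y ≡ᵇ 1} {true} (∧-true-r {x ≡ᵇ a} e)) (∧-true-l {x ≡ᵇ a} e)
  parts-bound : length ls * ind (sum ls ≡ᵇ suc a) ≤ suc a * ind (sum ls ≡ᵇ suc a)
  parts-bound with sum ls ≡ᵇ suc a in e
  ... | true = *-monoˡ-≤ 1 (subst (length ls ≤_) (≡ᵇ⇒≡′ _ _ e) (len≤sum ls ps))
  ... | false = ≤-reflexive (trans (*-zeroʳ (length ls)) (sym (*-zeroʳ (suc a))))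

module NonnegativeCombinations where
  open import Data.Integer using (+_; +≤+)
  import Data.Integer as ℤ
  import Data.Integer.Properties as ℤₚ
  open import Data.Rational as ℚ using (ℚ; 0ℚ; mkℚ; *≤*; toℚᵘ; NonNegative)
  import Data.Rational.Properties as ℚₚ
  import Data.Rational.Unnormalised as ℚᵘ
  import Data.Rational.Unnormalised.Properties as ℚᵘₚ
  import Data.Nat.Coprimality as Coprime
  open import Data.List using (foldr)

  toℚ≡mkℚ : ∀ n → toℚ n ≡ mkℚ (+ n) 0 (Coprime.sym (Coprime.1-coprimeTo n))
  toℚ≡mkℚ n = ℚₚ.normalize-coprime (Coprime.sym (Coprime.1-coprimeTo n))

  toℚ-cancel-≤ : ∀ m n → toℚ m ℚ.≤ toℚ n → m ≤ n
  toℚ-cancel-≤ m n le rewrite toℚ≡mkℚ m | toℚ≡mkℚ n with le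
  ... | *≤* p = ℤₚ.drop‿+≤+ (subst₂ ℤ._≤_ (ℤₚ.*-identityʳ (+ m)) (ℤₚ.*-identityʳ (+ n)) p)

  toℚ-mono-≤ : ∀ m n → m ≤ n → toℚ m ℚ.≤ toℚ n
  toℚ-mono-≤ m n le rewrite toℚ≡mkℚ m | toℚ≡mkℚ n =
    *≤* (subst₂ ℤ._≤_ (sym (ℤₚ.*-identityʳ (+ m))) (sym (ℤₚ.*-identityʳ (+ n))) (+≤+ le))

  toℚ-* : ∀ m n → toℚ (m * n) ≡ toℚ m ℚ.* toℚ n
  toℚ-* m n = ℚₚ.toℚᵘ-injective (ℚᵘₚ.≃-trans unnormalised (ℚᵘₚ.≃-sym (ℚₚ.toℚᵘ-homo-* (toℚ m) (toℚ n))))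
    where
    unnormalised : toℚᵘ (toℚ (m * n)) ℚᵘ.≃ (toℚᵘ (toℚ m) ℚᵘ.* toℚᵘ (toℚ n))
    unnormalised rewrite toℚ≡mkℚ (m * n) | toℚ≡mkℚ m | toℚ≡mkℚ n = ℚᵘ.*≡* (cong (ℤ._* + 1) (ℤₚ.pos-* m n))

  combination : List (List ℕ × ℚ) → List ℕ → ℚ
  combination L c = foldr (λ t acc → proj₂ t ℚ.* toℚ (pCoeff (proj₁ t) c) ℚ.+ acc) 0ℚ L

  combination-bound : ∀ N c₀ c₁ (L : List (List ℕ × ℚ)) →
    All (λ t → IsPartition (proj₁ t) × (0ℚ ℚ.≤ proj₂ t)) L →
    (∀ λs → IsPartition λs → pCoeff λs c₁ ≤ N * pCoeff λs c₀) →
    combination L c₁ ℚ.≤ toℚ N ℚ.* combination L c₀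
  combination-bound N c₀ c₁ [] [] bound = ℚₚ.≤-reflexive (sym (ℚₚ.*-zeroʳ (toℚ N)))
  combination-bound N c₀ c₁ ((λs , q) ∷ L) ((λs-partition , q≥0) ∷ L-ok) bound = begin
    q ℚ.* toℚ (pCoeff λs c₁) ℚ.+ combination L c₁
      ≤⟨ ℚₚ.+-mono-≤ term (combination-bound N c₀ c₁ L L-ok bound) ⟩
    toℚ N ℚ.* (q ℚ.* toℚ (pCoeff λs c₀)) ℚ.+ toℚ N ℚ.* combination L c₀
      ≡⟨ ℚₚ.*-distribˡ-+ (toℚ N) _ _ ⟨
    toℚ N ℚ.* (q ℚ.* toℚ (pCoeff λs c₀) ℚ.+ combination L c₀) ∎
    where
    open ℚₚ.≤-Reasoning
    instance
      q-nonNeg : NonNegative q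
      q-nonNeg = ℚ.nonNegative q≥0
    term : q ℚ.* toℚ (pCoeff λs c₁) ℚ.≤ toℚ N ℚ.* (q ℚ.* toℚ (pCoeff λs c₀))
    term = begin
      q ℚ.* toℚ (pCoeff λs c₁)                 ≤⟨ ℚₚ.*-monoˡ-≤-nonNeg q (toℚ-mono-≤ _ _ (bound λs λs-partition)) ⟩
      q ℚ.* toℚ (N * pCoeff λs c₀)             ≡⟨ cong (q ℚ.*_) (toℚ-* N (pCoeff λs c₀)) ⟩
      q ℚ.* (toℚ N ℚ.* toℚ (pCoeff λs c₀))     ≡⟨ ℚₚ.*-assoc q (toℚ N) _ ⟨
      q ℚ.* toℚ N ℚ.* toℚ (pCoeff λs c₀)       ≡⟨ cong (ℚ._* toℚ (pCoeff λs c₀)) (ℚₚ.*-comm q (toℚ N)) ⟩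
      toℚ N ℚ.* q ℚ.* toℚ (pCoeff λs c₀)       ≡⟨ ℚₚ.*-assoc (toℚ N) q _ ⟩
      toℚ N ℚ.* (q ℚ.* toℚ (pCoeff λs c₀)) ∎

  p-positive-bound : ∀ N c₀ c₁ → (∀ λs → IsPartition λs → pCoeff λs c₁ ≤ N * pCoeff λs c₀) →
    ∀ f → PPositive f → f c₁ ≤ N * f c₀
  p-positive-bound N c₀ c₁ bound f (L , L-ok , f≡) = toℚ-cancel-≤ _ _ (begin
    toℚ (f c₁)                          ≡⟨ f≡ c₁ ⟩
    combination L c₁                    ≤⟨ combination-bound N c₀ c₁ L L-ok bound ⟩
    toℚ N ℚ.* combination L c₀          ≡⟨ cong (toℚ N ℚ.*_) (f≡ c₀) ⟨
    toℚ N ℚ.* toℚ (f c₀)                ≡⟨ toℚ-* N (f c₀) ⟨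
    toℚ (N * f c₀) ∎)
    where open ℚₚ.≤-Reasoning

open NonnegativeCombinations using (p-positive-bound)

p-positive-hook-bound : ∀ f → PPositive f → ∀ a → f (a ∷ 1 ∷ []) ≤ suc a * f (suc a ∷ [])
p-positive-hook-bound f f-pos a =
  p-positive-bound (suc a) (suc a ∷ []) (a ∷ 1 ∷ []) (λ λs λs-partition → pCoeff-hook-bound a λs (proj₁ λs-partition)) f f-pos

-- Fillings of a ribbon by the letters 1' , 1 only: the leftmost box of every row
-- but the last sits above another box, so it must be 1'; every other box has a
-- left neighbour, so it must be 1.  Only the bottom-left box has a choice, hence
-- there are at most two such tableaux, whatever the content.
module OneLetter (α : List ℕ) (pos : All (0 <_) α) where
  open Ribbon α pos

  is1 is1′ value1 : Letter → Bool
  is1 x = (val x ≡ᵇ 1) ∧ not (marked x)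
  is1′ x = (val x ≡ᵇ 1) ∧ marked x
  value1 x = val x ≡ᵇ 1

  leftmostᵇ lastRowᵇ : Box → Bool
  leftmostᵇ (i , j) = ⌊ j ℕ.≟ S (pred i) ⌋
  lastRowᵇ (i , j) = ⌊ i ℕ.≟ ℓ ⌋

  admissible₁ : Box → Letter → Bool
  admissible₁ b = if leftmostᵇ b then (if lastRowᵇ b then value1 else is1′) else is1

  free₁ : Box → Bool
  free₁ b = leftmostᵇ b ∧ lastRowᵇ b

  choices₁ : ∀ b → count (admissible₁ b) (letters 1) ≡ suc (ind (free₁ b))
  choices₁ (i , j) with j ℕ.≟ S (pred i) | i ℕ.≟ ℓ
  ... | yes _ | yes _ = refl
  ... | yes _ | no _ = refl
  ... | no _ | _ = refl

  free₁⇒BL : ∀ b → free₁ b ≡ true → box≡ᵇ b BL ≡ true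
  free₁⇒BL (i , j) e with j ℕ.≟ S (pred i) | i ℕ.≟ ℓ
  free₁⇒BL (i , j) refl | yes refl | yes refl = box≡ᵇ-refl (i , j)

  letters1 : ∀ x → x ∈ letters 1 → x ≡ (1 , true) ⊎ x ≡ (1 , false)
  letters1 x (here e) = inj₁ e
  letters1 x (there (here e)) = inj₂ e

  -- In a tableau with entries in {1', 1}: a box with a box below it holds 1'
  -- (two unmarked 1 in a column are forbidden), a box with a box to its left
  -- holds 1 (two 1' in a row are forbidden).
  module _ (xs : List Letter) (len : length xs ≡ length D) (lets : All (_∈ letters 1) xs)
           (tab : isTableauᵇ (zip D xs) ≡ true) where

    letter∈ : ∀ b x → (b , x) ∈ zip D xs → x ≡ (1 , true) ⊎ x ≡ (1 , false)
    letter∈ b x b∈ = letters1 x (All.lookup lets (zip-letter∈ D xs b x b∈))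

    pair : ∀ p q → p ∈ zip D xs → q ∈ zip D xs → pairOK p q ≡ true
    pair p q p∈ q∈ = all⇒ (pairOK p) (zip D xs) (all⇒ _ (zip D xs) tab p p∈) q q∈

    above⇒1′ : ∀ i j x → ((i , j) , x) ∈ zip D xs → (suc i , j) ∈ D → x ≡ (1 , true)
    above⇒1′ i j x b∈ below∈D with y , below∈ ← zip-complete D xs len _ below∈D
      with letter∈ _ x b∈ | letter∈ _ y below∈ | pairOK-col i j x y (pair _ _ b∈ below∈)
    ... | inj₁ x≡ | _ | _ = x≡
    ... | inj₂ refl | inj₁ refl | () , _
    ... | inj₂ refl | inj₂ refl | _ , ()

    right⇒1 : ∀ i j x → ((i , suc j) , x) ∈ zip D xs → (i , j) ∈ D → x ≡ (1 , false)
    right⇒1 i j x b∈ left∈D with y , left∈ ← zip-complete D xs len _ left∈D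
      with letter∈ _ x b∈ | letter∈ _ y left∈ | pairOK-row i j y x (pair _ _ left∈ b∈)
    ... | inj₂ x≡ | _ | _ = x≡
    ... | inj₁ refl | inj₁ refl | _ , ()
    ... | inj₁ refl | inj₂ refl | () , _

    tableau⇒admissible₁ : ∀ b x → (b , x) ∈ zip D xs → admissible₁ b x ≡ true
    tableau⇒admissible₁ (i , j) x b∈ with ∈D⇒ i j (zip-box∈ D xs (i , j) x b∈)
    ... | k , k< , refl , S≤j , j< with j ℕ.≟ S k | suc k ℕ.≟ ℓ
    ...   | yes refl | yes _ with letter∈ _ x b∈
    ...     | inj₁ refl = refl
    ...     | inj₂ refl = refl
    tableau⇒admissible₁ (i , j) x b∈ | k , k< , refl , S≤j , j< | yes refl | no not-last
      rewrite above⇒1′ (suc k) (S k) x b∈ (below-start∈D k (≤∧≢⇒< k< not-last)) = refl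
    tableau⇒admissible₁ (i , suc j) x b∈ | k , k< , refl , S≤j , j< | no not-left | _
      rewrite right⇒1 (suc k) j x b∈
                (∈D⇐ k j k< (≤-pred (≤∧≢⇒< S≤j (λ e → not-left (sym e)))) (<-trans (n<1+n j) j<)) = refl
    tableau⇒admissible₁ (i , zero) x b∈ | k , k< , refl , S≤j , j< | no not-left | _
      with () ← ≤∧≢⇒< S≤j (λ e → not-left (sym e))

  one-letter-bound : ∀ c → rCoeff α (c ∷ []) ≤ 2
  one-letter-bound c = begin
    rCoeff α (c ∷ [])
      ≡⟨ count-filter tableau? F ⟩
    count tableau? F
      ≤⟨ count-mono tableau? (respects admissible₁ D) F forced ⟩
    count (respects admissible₁ D) F
      ≡⟨ count-respecting 1 admissible₁ D ⟩
    product (map (λ b → count (admissible₁ b) (letters 1)) D)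
      ≡⟨ cong product (map-cong choices₁ D) ⟩
    product (map (λ b → suc (ind (free₁ b))) D)
      ≡⟨ product-one-or-two free₁ D ⟩
    2 ^ count free₁ D
      ≤⟨ ^-monoʳ-≤ 2 (≤-trans (count-mono free₁ (λ b → box≡ᵇ b BL) D (λ b _ → free₁⇒BL b)) (D-once BL)) ⟩
    2 ∎
    where
    open ≤-Reasoning
    F : List (List Letter)
    F = fillings 1 (length D)
    tableau? : List Letter → Bool
    tableau? xs = isTableauᵇ (zip D xs) ∧ hasContentᵇ (c ∷ []) xs
    forced : ∀ xs → xs ∈ F → tableau? xs ≡ true → respects admissible₁ D xs ≡ true
    forced xs xs∈ e with len , lets ← fillings-shape 1 (length D) xs xs∈ =
      respects⇐ admissible₁ D xs len (tableau⇒admissible₁ xs len lets (∧-true-l e))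

-- Fillings by 1', 1, 2', 2 with a single 2 (or 2') placed in a box T.  Every
-- other box is forced as in the one-letter case, except that now the leftmost
-- box of the row above T also sits on T and so may be 1 or 1'.
module TwoLetter (α : List ℕ) (pos : All (0 <_) α) where
  open Ribbon α pos
  open OneLetter α pos using (is1; is1′; value1; leftmostᵇ; lastRowᵇ)

  value2 : Letter → Bool
  value2 x = val x ≡ᵇ 2

  admissible₂ : Box → Box → Letter → Bool
  admissible₂ (ti , tj) (i , j) =
    if ⌊ (i ℕ.≟ ti) ×-dec (j ℕ.≟ tj) ⌋ then value2
    else (if leftmostᵇ (i , j) then (if lastRowᵇ (i , j) ∨ ⌊ suc i ℕ.≟ ti ⌋ then value1 else is1′) else is1)

  free₂ : Box → Box → Bool
  free₂ (ti , tj) (i , j) =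
    ⌊ (i ℕ.≟ ti) ×-dec (j ℕ.≟ tj) ⌋ ∨ (leftmostᵇ (i , j) ∧ (lastRowᵇ (i , j) ∨ ⌊ suc i ℕ.≟ ti ⌋))

  choices₂ : ∀ T b → count (admissible₂ T b) (letters 2) ≡ suc (ind (free₂ T b))
  choices₂ (ti , tj) (i , j) with (i ℕ.≟ ti) ×-dec (j ℕ.≟ tj) | j ℕ.≟ S (pred i) | i ℕ.≟ ℓ | suc i ℕ.≟ ti
  ... | yes _ | _ | _ | _ = refl
  ... | no _ | yes _ | yes _ | _ = refl
  ... | no _ | yes _ | no _ | yes _ = refl
  ... | no _ | yes _ | no _ | no _ = refl
  ... | no _ | no _ | _ | _ = refl

  data Entry (ti tj i j : ℕ) (x : Letter) : Set where
    atT : i ≡ ti → j ≡ tj → val x ≡ 2 → Entry ti tj i j x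
    free : ¬ (i ≡ ti × j ≡ tj) → j ≡ S (pred i) → (i ≡ ℓ ⊎ suc i ≡ ti) → val x ≡ 1 → Entry ti tj i j x
    primed : ¬ (i ≡ ti × j ≡ tj) → j ≡ S (pred i) → x ≡ (1 , true) → Entry ti tj i j x
    plain : ¬ (i ≡ ti × j ≡ tj) → ¬ (j ≡ S (pred i)) → x ≡ (1 , false) → Entry ti tj i j x

  value≡ : ∀ (x : Letter) n → (val x ≡ᵇ n) ≡ true → val x ≡ n
  value≡ (v , m) n e = ≡ᵇ⇒≡′ v n e

  is1′⇒≡ : ∀ x → is1′ x ≡ true → x ≡ (1 , true)
  is1′⇒≡ (v , true) e = cong (_, true) (≡ᵇ⇒≡′ v 1 (∧-true-l e))
  is1′⇒≡ (v , false) e with () ← ∧-true-r {v ≡ᵇ 1} e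

  is1⇒≡ : ∀ x → is1 x ≡ true → x ≡ (1 , false)
  is1⇒≡ (v , false) e = cong (_, false) (≡ᵇ⇒≡′ v 1 (∧-true-l e))
  is1⇒≡ (v , true) e with () ← ∧-true-r {v ≡ᵇ 1} e

  entry : ∀ ti tj i j x → admissible₂ (ti , tj) (i , j) x ≡ true → Entry ti tj i j x
  entry ti tj i j x e with (i ℕ.≟ ti) ×-dec (j ℕ.≟ tj) | j ℕ.≟ S (pred i) | i ℕ.≟ ℓ | suc i ℕ.≟ ti
  ... | yes (i≡ , j≡) | _ | _ | _ = atT i≡ j≡ (value≡ x 2 e)
  ... | no not-T | yes left | yes last | _ = free not-T left (inj₁ last) (value≡ x 1 e)
  ... | no not-T | yes left | no _ | yes above = free not-T left (inj₂ above) (value≡ x 1 e)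
  ... | no not-T | yes left | no _ | no _ = primed not-T left (is1′⇒≡ x e)
  ... | no not-T | no not-left | _ | _ = plain not-T not-left (is1⇒≡ x e)

  val1≤val2 : ∀ (x y : Letter) → val x ≡ 1 → val y ≡ 2 → (x ≤Lᵇ y) ≡ true
  val1≤val2 (.1 , _) (.2 , _) refl refl = refl

  val1≤1 : ∀ (x : Letter) → val x ≡ 1 → (x ≤Lᵇ (1 , false)) ≡ true
  val1≤1 (.1 , true) refl = refl
  val1≤1 (.1 , false) refl = refl

  1′≤val : ∀ (y : Letter) → val y ≡ 1 ⊎ val y ≡ 2 → ((1 , true) ≤Lᵇ y) ≡ true
  1′≤val (.1 , _) (inj₁ refl) = refl
  1′≤val (.2 , _) (inj₂ refl) = refl

  -- A site: the rightmost box T = (kt+1 , E kt) of a row below the top one,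
  -- with nothing below T (its row is wider than one box, or it is the last row).
  record Site (kt tj : ℕ) : Set where
    field
      below-top : 1 ≤ kt
      in-D : kt < ℓ
      rightmost : tj ≡ E kt
      nothing-below : 2 ≤ W kt ⊎ suc kt ≡ ℓ

  module Family (kt tj : ℕ) (site : Site kt tj) where
    open Site site

    ti : ℕ
    ti = suc kt

    T : Box
    T = (ti , tj)

    T∈D : T ∈ D
    T∈D = subst (λ j → (ti , j) ∈ D) (sym rightmost) (end∈D kt in-D)

    T-alone : E kt ≤ S kt → suc kt ≡ ℓ
    T-alone E≤S with nothing-below
    ... | inj₂ last = last
    ... | inj₁ wide = ⊥-elim (<-irrefl refl (≤-trans wide (E≤S⇒W≤1 kt E≤S)))

    value-1-or-2 : ∀ {i j x} → Entry ti tj i j x → val x ≡ 1 ⊎ val x ≡ 2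
    value-1-or-2 (atT _ _ v) = inj₂ v
    value-1-or-2 (free _ _ _ v) = inj₁ v
    value-1-or-2 (primed _ _ refl) = inj₁ refl
    value-1-or-2 (plain _ _ refl) = inj₁ refl

    is-T : ∀ a j → a ≡ kt → j ≡ E a → (suc a ≡ ti × j ≡ tj)
    is-T a j refl j≡ = refl , trans j≡ (sym rightmost)

    row-order : ∀ a j₁ j₂ x₁ x₂ → (suc a , j₁) ∈ D → (suc a , j₂) ∈ D →
      Entry ti tj (suc a) j₁ x₁ → Entry ti tj (suc a) j₂ x₂ → j₂ ≡ suc j₁ → (x₁ ≤Lᵇ x₂) ≡ true
    row-order a j₁ j₂ x₁ x₂ b₁∈ b₂∈ e₁ e₂ j₂≡
      with _ , a< , refl , S≤j₁ , _ ← ∈D⇒ _ _ b₁∈ | _ , _ , refl , _ , j₂< ← ∈D⇒ _ _ b₂∈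
      with e₂ | e₁
    ... | atT _ j₂≡tj v₂ | atT _ j₁≡tj _ =
      ⊥-elim (<-irrefl (trans j₁≡tj (sym j₂≡tj)) (subst (j₁ <_) (sym j₂≡) ≤-refl))
    ... | atT _ _ v₂ | free _ _ _ v₁ = val1≤val2 x₁ x₂ v₁ v₂
    ... | atT _ _ v₂ | primed _ _ refl = 1′≤val x₂ (inj₂ v₂)
    ... | atT _ _ v₂ | plain _ _ refl = val1≤val2 x₁ x₂ refl v₂
    ... | free _ left _ _ | _ = ⊥-elim (<-irrefl refl (subst (_≤ j₁) (trans (sym left) j₂≡) S≤j₁))
    ... | primed _ left _ | _ = ⊥-elim (<-irrefl refl (subst (_≤ j₁) (trans (sym left) j₂≡) S≤j₁))
    ... | plain _ _ refl | atT a≡ j₁≡tj _ =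
      ⊥-elim (<-irrefl refl (subst (_< S a + W a) (trans j₂≡ (trans (cong suc (trans j₁≡tj rightmost′)) (suc-E a a<))) j₂<))
      where rightmost′ : tj ≡ E a
            rightmost′ = subst (λ k → tj ≡ E k) (suc-injective (sym a≡)) rightmost
    ... | plain _ _ refl | free _ _ _ v₁ = val1≤1 x₁ v₁
    ... | plain _ _ refl | primed _ _ refl = refl
    ... | plain _ _ refl | plain _ _ refl = refl

    T-nothing-below : ∀ al j → (suc kt , j) ∈ D → (suc al , j) ∈ D → j ≡ tj → kt < al → ⊥
    T-nothing-below al j T∈ low∈ j≡tj kt<al with _ , al< , refl , _ ← ∈D⇒ _ _ low∈ | same-column kt al j T∈ low∈ kt<al
    ... | j≡S , _ , _ = <-irrefl refl (<-≤-trans kt<al (≤-pred (subst (al <_) (sym (T-alone (≤-reflexive E≡S))) al<)))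
      where E≡S : E kt ≡ S kt
            E≡S = trans (sym rightmost) (trans (sym j≡tj) j≡S)

    column-order : ∀ a₁ a₂ j x₁ x₂ → (suc a₁ , j) ∈ D → (suc a₂ , j) ∈ D →
      Entry ti tj (suc a₁) j x₁ → Entry ti tj (suc a₂) j x₂ → a₂ ≡ suc a₁ → (x₁ ≤Lᵇ x₂) ≡ true
    column-order a₁ a₂ j x₁ x₂ up∈ low∈ e₁ e₂ refl
      with _ , a₂< , refl , _ ← ∈D⇒ _ _ low∈ | same-column a₁ a₂ j up∈ low∈ ≤-refl
    ... | j≡Sa₁ , j≡Ea₂ , _ with e₁
    ...   | atT a₁≡ j≡tj _ = ⊥-elim (T-nothing-below a₂ j (subst (λ i → (i , j) ∈ D) a₁≡ up∈) low∈ j≡tj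
                                       (subst (_< a₂) (suc-injective a₁≡) ≤-refl))
    ...   | primed _ _ refl = 1′≤val x₂ (value-1-or-2 e₂)
    ...   | plain _ not-left _ = ⊥-elim (not-left j≡Sa₁)
    ...   | free _ _ (inj₁ last) _ = ⊥-elim (<-irrefl last a₂<)
    ...   | free _ _ (inj₂ above) v₁ with e₂
    ...     | atT _ _ v₂ = val1≤val2 x₁ x₂ v₁ v₂
    ...     | free not-T _ _ _ = ⊥-elim (not-T (is-T a₂ j (suc-injective above) j≡Ea₂))
    ...     | primed not-T _ _ = ⊥-elim (not-T (is-T a₂ j (suc-injective above) j≡Ea₂))
    ...     | plain not-T _ _ = ⊥-elim (not-T (is-T a₂ j (suc-injective above) j≡Ea₂))

    column-unmarked : ∀ au al j xu xl → (suc au , j) ∈ D → (suc al , j) ∈ D →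
      Entry ti tj (suc au) j xu → Entry ti tj (suc al) j xl → au < al → marked xu ≡ false → val xu ≡ val xl → ⊥
    column-unmarked au al j xu xl up∈ low∈ eu el au<al unmarked same
      with _ , al< , refl , _ ← ∈D⇒ _ _ low∈ | same-column au al j up∈ low∈ au<al
    ... | j≡Sau , j≡Eal , j≡S[al-1] with eu
    ...   | atT au≡ j≡tj _ = T-nothing-below al j (subst (λ i → (i , j) ∈ D) au≡ up∈) low∈ j≡tj
                               (subst (_< al) (suc-injective au≡) au<al)
    ...   | primed _ _ refl = case unmarked of λ ()
    ...   | plain _ not-left _ = not-left j≡Sau
    ...   | free _ _ (inj₁ last) _ = <-irrefl refl (<-≤-trans (subst (al <_) (sym last) al<) au<al)
    ...   | free _ _ (inj₂ above) vu with <-cmp al kt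
    ...     | tri< al<kt _ _ = <-irrefl refl (<-≤-trans al<kt (subst (_≤ al) (suc-injective above) au<al))
    ...     | tri≈ _ al≡kt _ with el
    ...       | atT _ _ vl = case trans (sym vu) (trans same vl) of λ ()
    ...       | free not-T _ _ _ = not-T (is-T al j al≡kt j≡Eal)
    ...       | primed not-T _ _ = not-T (is-T al j al≡kt j≡Eal)
    ...       | plain not-T _ _ = not-T (is-T al j al≡kt j≡Eal)
    column-unmarked au al j xu xl up∈ low∈ eu el au<al unmarked same
      | j≡Sau , j≡Eal , j≡S[al-1] | free _ _ (inj₂ above) vu | tri> _ _ kt<al =
      <-irrefl refl (<-≤-trans al< (subst (_≤ al) (T-alone E≤S) kt<al))
      where
      E≤S : E kt ≤ S kt
      E≤S = begin
        E kt            ≡⟨ subst (λ k → S au ≡ E k) (suc-injective above)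
                               (S≡E au (subst (_< ℓ) (sym (suc-injective above)) in-D)) ⟨
        S au            ≡⟨ trans (sym j≡Sau) j≡S[al-1] ⟩
        S (pred al)     ≤⟨ S-antitone kt (pred al) (<⇒≤pred kt<al) (≤-trans (s≤s (pred[n]≤n {al})) al<) ⟩
        S kt ∎
        where open ≤-Reasoning

    -- no two primed letters of equal value in a row: 1' only occurs at the
    -- leftmost box of a row, and 2' only at T
    row-primed : ∀ a j₁ j₂ x₁ x₂ → Entry ti tj (suc a) j₁ x₁ → Entry ti tj (suc a) j₂ x₂ → ¬ j₁ ≡ j₂ →
      marked x₁ ≡ true → marked x₂ ≡ true → val x₁ ≡ val x₂ → ⊥
    row-primed a j₁ j₂ x₁ x₂ (atT _ j₁≡ _) (atT _ j₂≡ _) j₁≢j₂ _ _ _ = j₁≢j₂ (trans j₁≡ (sym j₂≡))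
    row-primed a j₁ j₂ x₁ x₂ (atT _ _ v₁) (free _ _ _ v₂) _ _ _ same = case trans (sym v₁) (trans same v₂) of λ ()
    row-primed a j₁ j₂ x₁ x₂ (atT _ _ v₁) (primed _ _ refl) _ _ _ same = case trans (sym v₁) same of λ ()
    row-primed a j₁ j₂ x₁ x₂ (free _ _ _ v₁) (atT _ _ v₂) _ _ _ same = case trans (sym v₁) (trans same v₂) of λ ()
    row-primed a j₁ j₂ x₁ x₂ (primed _ _ refl) (atT _ _ v₂) _ _ _ same = case trans same v₂ of λ ()
    row-primed a j₁ j₂ x₁ x₂ (free _ left₁ _ _) (free _ left₂ _ _) j₁≢j₂ _ _ _ = j₁≢j₂ (trans left₁ (sym left₂))
    row-primed a j₁ j₂ x₁ x₂ (free _ left₁ _ _) (primed _ left₂ _) j₁≢j₂ _ _ _ = j₁≢j₂ (trans left₁ (sym left₂))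
    row-primed a j₁ j₂ x₁ x₂ (primed _ left₁ _) (free _ left₂ _ _) j₁≢j₂ _ _ _ = j₁≢j₂ (trans left₁ (sym left₂))
    row-primed a j₁ j₂ x₁ x₂ (primed _ left₁ _) (primed _ left₂ _) j₁≢j₂ _ _ _ = j₁≢j₂ (trans left₁ (sym left₂))
    row-primed a j₁ j₂ x₁ x₂ (plain _ _ refl) _ _ () _ _
    row-primed a j₁ j₂ x₁ x₂ _ (plain _ _ refl) _ _ () _

    family-pairs : ∀ b₁ b₂ x₁ x₂ → b₁ ∈ D → b₂ ∈ D →
      admissible₂ T b₁ x₁ ≡ true → admissible₂ T b₂ x₂ ≡ true → pairOK (b₁ , x₁) (b₂ , x₂) ≡ true
    family-pairs (i₁ , j₁) (i₂ , j₂) x₁ x₂ b₁∈ b₂∈ ok₁ ok₂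
      with a₁ , _ , refl , _ ← ∈D⇒ _ _ b₁∈ | a₂ , _ , refl , _ ← ∈D⇒ _ _ b₂∈ =
      pairOK-intro (suc a₁) j₁ (suc a₂) j₂ x₁ x₂ rows columns unmarked primes
      where
      e₁ = entry ti tj (suc a₁) j₁ x₁ ok₁
      e₂ = entry ti tj (suc a₂) j₂ x₂ ok₂
      rows : suc a₁ ≡ suc a₂ → j₂ ≡ suc j₁ → (x₁ ≤Lᵇ x₂) ≡ true
      rows refl = row-order a₁ j₁ j₂ x₁ x₂ b₁∈ b₂∈ e₁ e₂
      columns : j₁ ≡ j₂ → suc a₂ ≡ suc (suc a₁) → (x₁ ≤Lᵇ x₂) ≡ true
      columns refl a₂≡ = column-order a₁ a₂ j₁ x₁ x₂ b₁∈ b₂∈ e₁ e₂ (suc-injective a₂≡)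
      unmarked : j₁ ≡ j₂ → ¬ suc a₁ ≡ suc a₂ → marked x₁ ≡ false → marked x₂ ≡ false → val x₁ ≡ val x₂ → ⊥
      unmarked refl a₁≢a₂ m₁ m₂ same with <-cmp a₁ a₂
      ... | tri< a₁<a₂ _ _ = column-unmarked a₁ a₂ j₁ x₁ x₂ b₁∈ b₂∈ e₁ e₂ a₁<a₂ m₁ same
      ... | tri≈ _ a₁≡a₂ _ = a₁≢a₂ (cong suc a₁≡a₂)
      ... | tri> _ _ a₂<a₁ = column-unmarked a₂ a₁ j₁ x₂ x₁ b₂∈ b₁∈ e₂ e₁ a₂<a₁ m₂ (sym same)
      primes : suc a₁ ≡ suc a₂ → ¬ j₁ ≡ j₂ → marked x₁ ≡ true → marked x₂ ≡ true → val x₁ ≡ val x₂ → ⊥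
      primes refl = row-primed a₁ j₁ j₂ x₁ x₂ e₁ e₂

    value2-at-T : ∀ b x → admissible₂ T b x ≡ true → value2 x ≡ box≡ᵇ b T
    value2-at-T (i , j) x ok with entry ti tj i j x ok
    ... | atT refl refl v = trans (cong (_≡ᵇ 2) v) (sym (box≡ᵇ-refl T))
    ... | free not-T _ _ v = trans (cong (_≡ᵇ 2) v) (sym (box≢⇒false (i , j) T (λ q → not-T (cong proj₁ q , cong proj₂ q))))
    ... | primed not-T _ refl = sym (box≢⇒false (i , j) T (λ q → not-T (cong proj₁ q , cong proj₂ q)))
    ... | plain not-T _ refl = sym (box≢⇒false (i , j) T (λ q → not-T (cong proj₁ q , cong proj₂ q)))

    family-tableau : ∀ xs → length xs ≡ length D → All (_∈ letters 2) xs → respects (admissible₂ T) D xs ≡ true →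
      isTableauᵇ (zip D xs) ∧ hasContentᵇ (size α ∸ 1 ∷ 1 ∷ []) xs ≡ true
    family-tableau xs len lets ok = ∧-intro tableau content
      where
      admissible-at : ∀ b x → (b , x) ∈ zip D xs → admissible₂ T b x ≡ true
      admissible-at = respects⇒ (admissible₂ T) D xs ok
      tableau : isTableauᵇ (zip D xs) ≡ true
      tableau = all⇐ _ (zip D xs) λ { (b₁ , x₁) p₁ → all⇐ _ (zip D xs) λ { (b₂ , x₂) p₂ →
        family-pairs b₁ b₂ x₁ x₂ (zip-box∈ D xs b₁ x₁ p₁) (zip-box∈ D xs b₂ x₂ p₂)
                                 (admissible-at b₁ x₁ p₁) (admissible-at b₂ x₂ p₂) } }
      twos : count value2 xs ≡ 1
      twos = begin
        count value2 xs                              ≡⟨ count-zip-letters value2 D xs len ⟩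
        count (λ p → value2 (proj₂ p)) (zip D xs)
          ≡⟨ count-cong _ _ (zip D xs) (λ { (b , x) p → value2-at-T b x (admissible-at b x p) }) ⟩
        count (λ p → box≡ᵇ (proj₁ p) T) (zip D xs)   ≡⟨ count-zip-boxes (λ b → box≡ᵇ b T) D xs len ⟨
        count (λ b → box≡ᵇ b T) D                    ≡⟨ ≤-antisym (D-once T) (count-pos _ D T T∈D (box≡ᵇ-refl T)) ⟩
        1 ∎
        where open ≡-Reasoning
      ones : count value1 xs ≡ size α ∸ 1
      ones = begin
        count value1 xs                              ≡⟨ m+n∸n≡m (count value1 xs) 1 ⟨
        count value1 xs + 1 ∸ 1                      ≡⟨ cong (λ n → count value1 xs + n ∸ 1) twos ⟨
        count value1 xs + count value2 xs ∸ 1        ≡⟨ cong (_∸ 1) (trans (values-1-2 xs lets) (trans len size-D)) ⟩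
        size α ∸ 1 ∎
        where open ≡-Reasoning
      content : hasContentᵇ (size α ∸ 1 ∷ 1 ∷ []) xs ≡ true
      content = ∧-intro (subst (λ c → (c ≡ᵇ size α ∸ 1) ≡ true) (sym (trans (count-filter value1 xs) ones))
                               (≡ᵇ-refl (size α ∸ 1)))
                        (∧-intro (subst (λ c → (c ≡ᵇ 1) ≡ true) (sym (trans (count-filter value2 xs) twos)) refl) refl)

    aboveT : Box
    aboveT = (kt , S (pred kt))

    aboveT∈D : aboveT ∈ D
    aboveT∈D = row-start kt below-top in-D
      where
      row-start : ∀ k → 1 ≤ k → k < ℓ → (k , S (pred k)) ∈ D
      row-start (suc k) _ k< = start∈D k (<-trans (n<1+n k) k<)

    is : Box → Box → Bool
    is X b = box≡ᵇ b X

    is⇒ : ∀ X → free₂ T X ≡ true → ∀ b → is X b ≡ true → free₂ T b ≡ true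
    is⇒ X X-free b b-is-X rewrite box≡ᵇ⇒≡ b X b-is-X = X-free

    T-free : free₂ T T ≡ true
    T-free with (ti ℕ.≟ ti) ×-dec (tj ℕ.≟ tj)
    ... | yes _ = refl
    ... | no not-T = ⊥-elim (not-T (refl , refl))

    aboveT-free : free₂ T aboveT ≡ true
    aboveT-free with (kt ℕ.≟ ti) ×-dec (S (pred kt) ℕ.≟ tj) | S (pred kt) ℕ.≟ S (pred kt) | suc kt ℕ.≟ ti
    ... | yes (kt≡ti , _) | _ | _ = ⊥-elim (<-irrefl kt≡ti (n<1+n kt))
    ... | no _ | yes _ | yes _ = ∨-zeroʳ _
    ... | no _ | no ≢ | _ = ⊥-elim (≢ refl)
    ... | no _ | yes _ | no ≢ = ⊥-elim (≢ refl)

    BL-free : free₂ T BL ≡ true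
    BL-free with (ℓ ℕ.≟ ti) ×-dec (S (pred ℓ) ℕ.≟ tj) | S (pred ℓ) ℕ.≟ S (pred ℓ) | ℓ ℕ.≟ ℓ
    ... | yes _ | _ | _ = refl
    ... | no _ | yes _ | yes _ = refl
    ... | no _ | no ≢ | _ = ⊥-elim (≢ refl)
    ... | no _ | yes _ | no ≢ = ⊥-elim (≢ refl)

    distinct : ∀ X Y → ¬ X ≡ Y → ∀ b → is X b ≡ true → is Y b ≡ true → ⊥
    distinct X Y X≢Y b b-is-X b-is-Y = X≢Y (trans (sym (box≡ᵇ⇒≡ b X b-is-X)) (box≡ᵇ⇒≡ b Y b-is-Y))

    T≢aboveT : ¬ T ≡ aboveT
    T≢aboveT e = <-irrefl (sym (cong proj₁ e)) (n<1+n kt)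

    T-or-above : 2 ≤ count (λ b → is T b ∨ is aboveT b) D
    T-or-above = ≤-trans (+-mono-≤ (count-pos (is T) D T T∈D (box≡ᵇ-refl T))
                                   (count-pos (is aboveT) D aboveT aboveT∈D (box≡ᵇ-refl aboveT)))
      (count-disjoint (is T) (is aboveT) _ D (λ b → ∨-introˡ) (λ b → ∨-introʳ (is T b)) (distinct T aboveT T≢aboveT))

    T-or-above-free : ∀ b → is T b ∨ is aboveT b ≡ true → free₂ T b ≡ true
    T-or-above-free b e with is T b in b-is-T
    ... | true = is⇒ T T-free b b-is-T
    ... | false = is⇒ aboveT aboveT-free b e

    three-free : ¬ BL ≡ T → 3 ≤ count (free₂ T) D
    three-free BL≢T =
      ≤-trans (+-mono-≤ T-or-above (count-pos (is BL) D BL (BL∈D (≤-trans (s≤s z≤n) in-D)) (box≡ᵇ-refl BL)))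
      (count-disjoint _ (is BL) (free₂ T) D T-or-above-free (is⇒ BL BL-free) not-both)
      where
      not-both : ∀ b → is T b ∨ is aboveT b ≡ true → is BL b ≡ true → ⊥
      not-both b e b-is-BL with is T b in b-is-T
      ... | true = distinct BL T BL≢T b b-is-BL b-is-T
      ... | false = distinct BL aboveT (λ BL≡ → <-irrefl (sym (cong proj₁ BL≡)) in-D) b b-is-BL e

    family-size : count (respects (admissible₂ T) D) (fillings 2 (length D)) ≡ 2 ^ count (free₂ T) D
    family-size = trans (count-respecting 2 (admissible₂ T) D)
                        (trans (cong product (map-cong (choices₂ T) D)) (product-one-or-two (free₂ T) D))

    family≥4 : 4 ≤ count (respects (admissible₂ T) D) (fillings 2 (length D))
    family≥4 = subst (4 ≤_) (sym family-size)
                     (^-monoʳ-≤ 2 (≤-trans T-or-above (count-mono _ _ D (λ b _ → T-or-above-free b))))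

    family≥8 : ¬ BL ≡ T → 8 ≤ count (respects (admissible₂ T) D) (fillings 2 (length D))
    family≥8 BL≢T = subst (8 ≤_) (sym family-size) (^-monoʳ-≤ 2 (three-free BL≢T))

  siteᵇ : Box → Bool
  siteᵇ (i , j) = ⌊ 2 ≤? i ⌋ ∧ (⌊ j ℕ.≟ E (pred i) ⌋ ∧ (⌊ 2 ≤? W (pred i) ⌋ ∨ ⌊ i ℕ.≟ ℓ ⌋))

  siteᵇ⇒Site : ∀ i j → (i , j) ∈ D → siteᵇ (i , j) ≡ true → ∃ λ kt → i ≡ suc kt × Site kt j
  siteᵇ⇒Site i j b∈ e with k , k< , refl , _ ← ∈D⇒ i j b∈
    with 2 ≤? suc k | j ℕ.≟ E k | 2 ≤? W k | suc k ℕ.≟ ℓ | e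
  ... | yes (s≤s 1≤k) | yes j≡ | yes wide | _ | _ =
    k , refl , record { below-top = 1≤k ; in-D = k< ; rightmost = j≡ ; nothing-below = inj₁ wide }
  ... | yes (s≤s 1≤k) | yes j≡ | no _ | yes last | _ =
    k , refl , record { below-top = 1≤k ; in-D = k< ; rightmost = j≡ ; nothing-below = inj₂ last }
  ... | yes _ | yes _ | no _ | no _ | ()
  ... | yes _ | no _ | _ | _ | ()
  ... | no _ | _ | _ | _ | ()

  -- Every corner is a site: a corner has a box above it, so it is not in the top
  -- row and is the rightmost box of its row; it has no box below it.
  corner⇒site : ∀ b → b ∈ D → isCorner D b ≡ true → siteᵇ b ≡ true
  corner⇒site (i , j) b∈ e with k , k< , refl , _ ← ∈D⇒ i j b∈
    with k₀ , _ , refl , _ ← ∈D⇒ k j (memᵇ-sound (k , j) D (∧-true-l e))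
    with _ , j≡E , _ ← same-column k₀ (suc k₀) j (memᵇ-sound (suc k₀ , j) D (∧-true-l e)) b∈ ≤-refl
    with 2 ≤? suc (suc k₀) | j ℕ.≟ E (suc k₀) | 2 ≤? W (suc k₀) | suc (suc k₀) ℕ.≟ ℓ
  ... | yes _ | yes _ | yes _ | _ = refl
  ... | yes _ | yes _ | no _ | yes _ = refl
  ... | no ≱ | _ | _ | _ = ⊥-elim (≱ (s≤s (s≤s z≤n)))
  ... | yes _ | no j≢ | _ | _ = ⊥-elim (j≢ j≡E)
  ... | yes _ | yes _ | no narrow | no not-last
    rewrite memᵇ-complete _ D (subst (λ c → (suc (suc (suc k₀)) , c) ∈ D)
                                     (sym (trans j≡E (W≤1⇒E≡S (suc k₀) k< (≤-pred (≰⇒> narrow)))))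
                                     (below-start∈D (suc k₀) (≤∧≢⇒< k< not-last)))
    with () ← ∧-true-r {memᵇ (suc k₀ , j) D} e

  -- Families of different sites are disjoint: the box holding the 2 is the site.
  value2-at-site : ∀ i j x → admissible₂ (i , j) (i , j) x ≡ true → val x ≡ 2
  value2-at-site i j x ok with entry i j i j x ok
  ... | atT _ _ v = v
  ... | free not-T _ _ _ = ⊥-elim (not-T (refl , refl))
  ... | primed not-T _ _ = ⊥-elim (not-T (refl , refl))
  ... | plain not-T _ _ = ⊥-elim (not-T (refl , refl))

  value1-off-site : ∀ ti tj i j x → admissible₂ (ti , tj) (i , j) x ≡ true → ¬ (i ≡ ti × j ≡ tj) → val x ≡ 1
  value1-off-site ti tj i j x ok not-T with entry ti tj i j x ok
  ... | atT i≡ j≡ _ = ⊥-elim (not-T (i≡ , j≡))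
  ... | free _ _ _ v = v
  ... | primed _ _ refl = refl
  ... | plain _ _ refl = refl

  F₂ : List (List Letter)
  F₂ = fillings 2 (length D)

  tableau₂? : List Letter → Bool
  tableau₂? xs = isTableauᵇ (zip D xs) ∧ hasContentᵇ (size α ∸ 1 ∷ 1 ∷ []) xs

  in-family : Box → List Letter → Bool
  in-family b xs = siteᵇ b ∧ respects (admissible₂ b) D xs

  in-family⇒tableau : ∀ b xs → b ∈ D → xs ∈ F₂ → in-family b xs ≡ true → tableau₂? xs ≡ true
  in-family⇒tableau (i , j) xs b∈ xs∈ e with kt , refl , site ← siteᵇ⇒Site i j b∈ (∧-true-l e)
    with len , lets ← fillings-shape 2 (length D) xs xs∈ =
    Family.family-tableau kt j site xs len lets (∧-true-r {siteᵇ (i , j)} e)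

  at-most-one-family : ∀ xs → xs ∈ F₂ → count (λ b → in-family b xs) D ≤ ind (tableau₂? xs)
  at-most-one-family xs xs∈ with count (λ b → in-family b xs) D in c≡
  ... | zero = z≤n
  ... | suc _ with b₀ , b₀∈ , b₀-family ← count-witness (λ b → in-family b xs) D (subst (1 ≤_) (sym c≡) (s≤s z≤n))
    rewrite in-family⇒tableau b₀ xs b₀∈ xs∈ b₀-family =
    subst (_≤ 1) c≡ (≤-trans (count-mono _ (λ b → box≡ᵇ b b₀) D same-site) (D-once b₀))
    where
    len : length xs ≡ length D
    len = proj₁ (fillings-shape 2 (length D) xs xs∈)
    same-site : ∀ b → b ∈ D → in-family b xs ≡ true → box≡ᵇ b b₀ ≡ true
    same-site (i , j) b∈ e with box≡ᵇ (i , j) b₀ in b≡b₀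
    ... | true = refl
    ... | false with x , b-x∈ ← zip-complete D xs len (i , j) b∈ = ⊥-elim (case trans (sym two) one of λ ())
      where
      two : val x ≡ 2
      two = value2-at-site i j x (respects⇒ _ D xs (∧-true-r {siteᵇ (i , j)} e) (i , j) x b-x∈)
      one : val x ≡ 1
      one = value1-off-site (proj₁ b₀) (proj₂ b₀) i j x (respects⇒ _ D xs (∧-true-r {siteᵇ b₀} b₀-family) (i , j) x b-x∈)
              (λ { (refl , refl) → case trans (sym b≡b₀) (box≡ᵇ-refl (i , j)) of λ () })

  familySize : Box → ℕ
  familySize b = count (respects (admissible₂ b) D) F₂

  families≤tableaux : sum (map (λ b → ind (siteᵇ b) * familySize b) D) ≤ count tableau₂? F₂
  families≤tableaux = subst (_≤ count tableau₂? F₂) (cong sum (map-cong (λ b → count-const-∧ (siteᵇ b) _ F₂) D))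
    (double-count in-family tableau₂? D F₂ at-most-one-family)

  family-bound : ∀ b → b ∈ D → ind (siteᵇ b) * 8 ≤ ind (siteᵇ b) * familySize b + ind (box≡ᵇ b BL) * 4
  family-bound (i , j) b∈ with siteᵇ (i , j) in site?
  ... | false = z≤n
  ... | true with kt , refl , site ← siteᵇ⇒Site i j b∈ site? | box≡ᵇ (suc kt , j) BL in b≡BL
  ...   | true = +-monoˡ-≤ 4 (subst (4 ≤_) (sym (+-identityʳ _)) (Family.family≥4 kt j site))
  ...   | false = ≤-trans (subst (8 ≤_) (sym (+-identityʳ _)) (Family.family≥8 kt j site BL≢T)) (m≤m+n _ _)
    where
    BL≢T : ¬ BL ≡ (suc kt , j)
    BL≢T BL≡T = case trans (sym b≡BL) (trans (cong (λ c → box≡ᵇ c BL) (sym BL≡T)) (box≡ᵇ-refl BL)) of λ ()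

  sites≤tableaux : count siteᵇ D * 8 ≤ count tableau₂? F₂ + 4
  sites≤tableaux = begin
    count siteᵇ D * 8
      ≡⟨ sum-ind-* siteᵇ 8 D ⟨
    sum (map (λ b → ind (siteᵇ b) * 8) D)
      ≤⟨ sum-mono _ _ D family-bound ⟩
    sum (map (λ b → ind (siteᵇ b) * familySize b + ind (box≡ᵇ b BL) * 4) D)
      ≡⟨ sum-+ (λ b → ind (siteᵇ b) * familySize b) (λ b → ind (box≡ᵇ b BL) * 4) D ⟩
    sum (map (λ b → ind (siteᵇ b) * familySize b) D) + sum (map (λ b → ind (box≡ᵇ b BL) * 4) D)
      ≤⟨ +-mono-≤ families≤tableaux (subst (_≤ 4) (sym (sum-ind-* (λ b → box≡ᵇ b BL) 4 D)) (*-monoˡ-≤ 4 (D-once BL))) ⟩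
    count tableau₂? F₂ + 4 ∎
    where open ≤-Reasoning

  two-letter-bound : corners α * 8 ≤ rCoeff α (size α ∸ 1 ∷ 1 ∷ []) + 4
  two-letter-bound = begin
    corners α * 8              ≡⟨ cong (_* 8) (count-filter (isCorner D) D) ⟩
    count (isCorner D) D * 8   ≤⟨ *-monoˡ-≤ 8 (count-mono (isCorner D) siteᵇ D corner⇒site) ⟩
    count siteᵇ D * 8          ≤⟨ sites≤tableaux ⟩
    count tableau₂? F₂ + 4     ≡⟨ cong (_+ 4) (count-filter tableau₂? F₂) ⟨
    rCoeff α (size α ∸ 1 ∷ 1 ∷ []) + 4 ∎
    where open ≤-Reasoning

-- The numerical contradiction: 4c ≥ n + 3 forces 8c ≥ 2n + 6, while
-- 8c ≤ r₁ + 4 ≤ n r₀ + 4 ≤ 2n + 4.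
too-many-corners : ∀ n c r₀ r₁ → 2 + n < 4 * c → c * 8 ≤ r₁ + 4 → r₁ ≤ n * r₀ → r₀ ≤ 2 → ⊥
too-many-corners n c r₀ r₁ many r₁-lower r₁-upper r₀-upper = <-irrefl refl (≤-trans (n≤1+n _) (begin
  2 + (n * 2 + 4) ≡⟨ twice n ⟩
  2 * (3 + n)     ≤⟨ *-monoʳ-≤ 2 many ⟩
  2 * (4 * c)     ≡⟨ eight c ⟩
  c * 8           ≤⟨ r₁-lower ⟩
  r₁ + 4          ≤⟨ +-monoˡ-≤ 4 (≤-trans r₁-upper (*-monoʳ-≤ n r₀-upper)) ⟩
  n * 2 + 4 ∎))
  where
  open ≤-Reasoning
  twice : ∀ n → 2 + (n * 2 + 4) ≡ 2 * (3 + n)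
  twice = solve-∀
  eight : ∀ c → 2 * (4 * c) ≡ c * 8
  eight = solve-∀

corollary4p11 : (rest : List ℕ) → All (λ a → 0 < a) rest →
    2 + size (1 ∷ rest) < 4 * corners (1 ∷ rest) →
    ¬ PPositive (𝔯 (1 ∷ rest))
corollary4p11 rest pos many p-positive =
  too-many-corners n (corners α) (𝔯 α (n ∷ [])) (𝔯 α (n ∸ 1 ∷ 1 ∷ [])) many
    (TwoLetter.two-letter-bound α pos′)
    (p-positive-hook-bound (𝔯 α) p-positive (n ∸ 1))
    (OneLetter.one-letter-bound α pos′ n)
  where
  α : List ℕ
  α = 1 ∷ rest
  pos′ : All (0 <_) α
  pos′ = s≤s z≤n ∷ pos
  n : ℕ
  n = size α
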